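{- Let $\mathrm{Pas}=\mathcal{R}\big(\tfrac{1}{1-t},\tfrac{t}{1-t}\big)$ and $\mathrm{Pas}^{ -1}=\mathcal{R}\big(\tfrac{1}{1+t},\tfrac{t}{1+t}\big)$, and let $A_i(t)$ denote the $i$th Eulerian polynomial. Then for every $i\ge0$, $$\mathrm{Der}^{2i}(\mathrm{Pas})=\mathcal{R}\Big(\frac{A_i(t)}{(1-t)^{i+1}},\frac{tA_i(t)}{(1-t)^{i+1}}\Big),\qquad \mathrm{Der}^{2i+1}(\mathrm{Pas})=\mathcal{R}\Big(\frac{A_{i+1}(t)}{(1-t)^{i+2}},\frac{tA_i(t)}{(1-t)^{i+1}}\Big),$$ $$\mathrm{Der}^{2i}(\mathrm{Pas}^{ -1})=\mathcal{R}\Big(\frac{A_i(-t)}{(1+t)^{i+1}},\frac{tA_i(-t)}{(1+t)^{i+1}}\Big),\qquad \mathrm{Der}^{2i+1}(\mathrm{Pas}^{ -1})=\mathcal{R}\Big(\frac{A_{i+1}(-t)}{(1+t)^{i+2}},\frac{tA_i(-t)}{(1+t)^{i+1}}\Big).$$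
   Context: For formal power series $d(t),h(t)$ with $d(0)\neq0$, $h(0)=0$, $h'(0)\neq0$, $\mathcal{R}(d(t),h(t))$ is the infinite lower triangular matrix with $(n,k)$-entry $[t^n]\,d(t)h(t)^k$ ($n,k\ge0$). $\mathrm{Der}(\mathcal{R}(d(t),h(t)))=\mathcal{R}(h'(t),t\,d(t))$ and $\mathrm{Der}^k$ is $\mathrm{Der}$ iterated $k$ times. The Eulerian polynomial is $A_n(t)=\sum_{\sigma\in S_n}t^{\mathrm{des}(\sigma)}$ for $n\ge1$, where $\mathrm{des}(\sigma)$ is the number of $i\in\{1,\dots,n-1\}$ with $\sigma(i)>\sigma(i+1)$; and $A_0(t)=1$. (So $A_1=1$, $A_2=1+t$, $A_3=1+4t+t^2$.) -}

module Defs where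

open import Data.Nat as ℕ using (ℕ; zero; suc; _≡ᵇ_; _<ᵇ_)
open import Data.Integer as ℤ using (ℤ; +_; _+_; _*_; -_; _-_)
open import Data.Bool using (Bool; true; false; if_then_else_)
open import Data.List as L using (List; []; _∷_; map; concatMap; upTo; filterᵇ; length; foldr)
open import Data.Bool.ListAction using (all; any)
open import Data.Vec as V using (Vec; []; _∷_; tabulate; zipWith; head; lookup)
open import Data.Fin using (Fin; toℕ)
open import Data.Product using (_×_; _,_; proj₁; proj₂)

FPS : Set
FPS = ℕ → ℤ

sumℤ : List ℤ → ℤ
sumℤ = foldr _+_ (+ 0)

sumVℤ : ∀ {n} → Vec ℤ n → ℤ
sumVℤ = V.foldr _ _+_ (+ 0)

one : FPS
one zero    = + 1
one (suc _) = + 0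

X : FPS
X 1 = + 1
X _ = + 0

_⊕_ : FPS → FPS → FPS
(a ⊕ b) n = a n + b n

_⊖_ : FPS → FPS → FPS
(a ⊖ b) n = a n - b n

_⊛_ : FPS → FPS → FPS
(a ⊛ b) n = sumℤ (map (λ k → a k * b (n ℕ.∸ k)) (upTo (suc n)))

pow : FPS → ℕ → FPS
pow a zero    = one
pow a (suc m) = a ⊛ pow a m

deriv : FPS → FPS
deriv a n = + (suc n) * a (suc n)

negArg : FPS → FPS
negArg a n = (ℤ.-1ℤ ℤ.^ n) * a n

-- Multiplicative inverse of a series whose constant term is a unit of ℤ
-- (i.e. a 0 ∈ {1, -1}, so 1/a 0 = a 0):
--   b 0 = a 0,  b n = - a 0 * Σ_{k=1}^{n} a k * b (n - k).
-- invVec a n = [b n, b (n-1), …, b 0].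
invVec : FPS → (n : ℕ) → Vec ℤ (suc n)
invVec a zero    = a 0 ∷ []
invVec a (suc n) =
  let v = invVec a n in
  (- (a 0 * sumVℤ (zipWith _*_ (tabulate (λ (j : Fin (suc n)) → a (suc (toℕ j)))) v))) ∷ v

inv : FPS → FPS
inv a n = head (invVec a n)

Riordan : FPS → FPS → ℕ → ℕ → ℤ
Riordan d h n k = (d ⊛ pow h k) n

Der : FPS × FPS → FPS × FPS
Der (d , h) = deriv h , (X ⊛ d)

Der^ : ℕ → FPS × FPS → FPS × FPS
Der^ zero    p = p
Der^ (suc k) p = Der (Der^ k p)

RiordanP : FPS × FPS → ℕ → ℕ → ℤ
RiordanP p = Riordan (proj₁ p) (proj₂ p)

oneMinusT onePlusT : FPS
oneMinusT = one ⊖ X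
onePlusT  = one ⊕ X

Pas : FPS × FPS
Pas = inv oneMinusT , (X ⊛ inv oneMinusT)

PasInv : FPS × FPS
PasInv = inv onePlusT , (X ⊛ inv onePlusT)

-- Eulerian polynomials A_n(t) = Σ_{σ ∈ S_n} t^{des σ}.
-- A permutation σ ∈ S_n is represented by its one-line word
-- [σ(1), …, σ(n)]: a length-n word over {1..n} containing every j ∈ {1..n}.

words : ℕ → ℕ → List (List ℕ)
words zero    n = [] ∷ []
words (suc m) n = concatMap (λ w → map (λ x → x ∷ w) (map suc (upTo n))) (words m n)

elemᵇ : ℕ → List ℕ → Bool
elemᵇ j w = any (λ x → x ≡ᵇ j) w

isPerm : ℕ → List ℕ → Bool
isPerm n w = all (λ j → elemᵇ j w) (map suc (upTo n))

perms : ℕ → List (List ℕ)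
perms n = filterᵇ (isPerm n) (words n n)

des : List ℕ → ℕ
des (x ∷ y ∷ r) = (if y <ᵇ x then 1 else 0) ℕ.+ des (y ∷ r)
des _           = 0

Eulerian : ℕ → FPS
Eulerian n k = + length (filterᵇ (λ σ → des σ ≡ᵇ k) (perms n))

-- With P_i = sucPow i = Σₙ (n+1)^i tⁿ one has d/dt (t P_i) = P_{i+1}, so Der sends (P_i , t P_i) to
-- (P_{i+1} , t P_i) and that to (P_{i+1} , t P_{i+1}); as Pas = (P_0 , t P_0) and Pas⁻¹ is its image
-- under t ↦ -t, the theorem reduces to Carlitz's identity (1-t)^{i+1} P_i = A_i.  Since
-- P_{i+1} = (1 + θ) P_i with θ = t d/dt, the Leibniz rule for θ turns the identity at i + 1 into the
-- recurrence A(i+1, k+1) = (k+2) A(i, k+1) + (i-k) A(i, k).  That recurrence comes from inserting the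
-- letter i + 1 into a permutation σ ∈ S_i at each of its i + 1 positions: every insertion keeps des σ
-- or raises it by one, and the insertions have i (des σ + 1) descents in total, which fixes how many
-- do which.

module Submission where

open import Defs

module PowerSeries where

  open import Data.Nat using (ℕ; zero; suc; _∸_)
  open import Data.Integer using (ℤ; +_; _+_; _*_; -_; _-_; -1ℤ; _^_)
  import Data.Integer.Properties as ℤ
  open import Data.Integer.Tactic.RingSolver using (solve-∀)
  open import Data.List using (applyUpTo)
  open import Data.List.Properties using (map-upTo)
  open import Data.Vec as Vec using (Vec; []; _∷_; tabulate; zipWith; lookup)
  import Data.Vec.Properties as Vec
  open import Data.Fin using (Fin; toℕ)
  import Data.Fin as Fin
  open import Function using (_∘_)
  open import Relation.Binary.PropositionalEquality
  open ≡-Reasoning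

  shift : FPS → FPS
  shift a n = a (suc n)

  zeroSeries : FPS
  zeroSeries _ = + 0

  infixr 7 _·_
  _·_ : ℤ → FPS → FPS
  (c · a) n = c * a n

  ⊛-coeff : ∀ a b n → (a ⊛ b) n ≡ sumℤ (applyUpTo (λ k → a k * b (n ∸ k)) (suc n))
  ⊛-coeff a b n = cong sumℤ (map-upTo (λ k → a k * b (n ∸ k)) (suc n))

  shift-⊛ : ∀ a b → shift (a ⊛ b) ≗ (a 0 · shift b) ⊕ (shift a ⊛ b)
  shift-⊛ a b n = trans (⊛-coeff a b (suc n)) (cong (_+_ (a 0 * b (suc n))) (sym (⊛-coeff (shift a) b n)))

  ⊛-cong : ∀ {a a′ b b′} → a ≗ a′ → b ≗ b′ → a ⊛ b ≗ a′ ⊛ b′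
  ⊛-cong a≗a′ b≗b′ zero = cong (_+ + 0) (cong₂ _*_ (a≗a′ 0) (b≗b′ 0))
  ⊛-cong {a} {a′} {b} {b′} a≗a′ b≗b′ (suc n) = begin
    (a ⊛ b) (suc n)                         ≡⟨ shift-⊛ a b n ⟩
    a 0 * b (suc n) + (shift a ⊛ b) n       ≡⟨ cong₂ _+_ (cong₂ _*_ (a≗a′ 0) (b≗b′ (suc n)))
                                                         (⊛-cong (a≗a′ ∘ suc) b≗b′ n) ⟩
    a′ 0 * b′ (suc n) + (shift a′ ⊛ b′) n   ≡⟨ shift-⊛ a′ b′ n ⟨
    (a′ ⊛ b′) (suc n)                       ∎

  ⊛-congˡ : ∀ a {b b′} → b ≗ b′ → a ⊛ b ≗ a ⊛ b′
  ⊛-congˡ a = ⊛-cong {a} {a} (λ _ → refl)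

  ⊛-congʳ : ∀ b {a a′} → a ≗ a′ → a ⊛ b ≗ a′ ⊛ b
  ⊛-congʳ b a≗a′ = ⊛-cong {b = b} {b′ = b} a≗a′ (λ _ → refl)

  ⊛-zeroˡ : ∀ b → zeroSeries ⊛ b ≗ zeroSeries
  ⊛-zeroˡ b zero    = refl
  ⊛-zeroˡ b (suc n) = trans (shift-⊛ zeroSeries b n) (trans (ℤ.+-identityˡ _) (⊛-zeroˡ b n))

  ⊛-identityˡ : ∀ b → one ⊛ b ≗ b
  ⊛-identityˡ b zero    = trans (ℤ.+-identityʳ _) (ℤ.*-identityˡ (b 0))
  ⊛-identityˡ b (suc n) = begin
    (one ⊛ b) (suc n)                          ≡⟨ shift-⊛ one b n ⟩
    + 1 * b (suc n) + (zeroSeries ⊛ b) n       ≡⟨ cong₂ _+_ (ℤ.*-identityˡ (b (suc n))) (⊛-zeroˡ b n) ⟩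
    b (suc n) + + 0                            ≡⟨ ℤ.+-identityʳ _ ⟩
    b (suc n)                                  ∎

  ⊛-distribʳ-⊕ : ∀ a b c → (a ⊕ b) ⊛ c ≗ (a ⊛ c) ⊕ (b ⊛ c)
  ⊛-distribʳ-⊕ a b c zero = distrib (a 0) (b 0) (c 0)
    where distrib : ∀ x y z → (x + y) * z + + 0 ≡ x * z + + 0 + (y * z + + 0)
          distrib = solve-∀
  ⊛-distribʳ-⊕ a b c (suc n) = begin
    ((a ⊕ b) ⊛ c) (suc n)
      ≡⟨ shift-⊛ (a ⊕ b) c n ⟩
    (a 0 + b 0) * c (suc n) + ((shift a ⊕ shift b) ⊛ c) n
      ≡⟨ cong (_+_ ((a 0 + b 0) * c (suc n))) (⊛-distribʳ-⊕ (shift a) (shift b) c n) ⟩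
    (a 0 + b 0) * c (suc n) + ((shift a ⊛ c) n + (shift b ⊛ c) n)
      ≡⟨ distrib (a 0) (b 0) (c (suc n)) _ _ ⟩
    (a 0 * c (suc n) + (shift a ⊛ c) n) + (b 0 * c (suc n) + (shift b ⊛ c) n)
      ≡⟨ cong₂ _+_ (shift-⊛ a c n) (shift-⊛ b c n) ⟨
    (a ⊛ c) (suc n) + (b ⊛ c) (suc n) ∎
    where distrib : ∀ x y z u v → (x + y) * z + (u + v) ≡ (x * z + u) + (y * z + v)
          distrib = solve-∀

  ⊛-distribˡ-⊕ : ∀ a b c → a ⊛ (b ⊕ c) ≗ (a ⊛ b) ⊕ (a ⊛ c)
  ⊛-distribˡ-⊕ a b c zero = distrib (a 0) (b 0) (c 0)
    where distrib : ∀ x y z → x * (y + z) + + 0 ≡ x * y + + 0 + (x * z + + 0)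
          distrib = solve-∀
  ⊛-distribˡ-⊕ a b c (suc n) = begin
    (a ⊛ (b ⊕ c)) (suc n)
      ≡⟨ shift-⊛ a (b ⊕ c) n ⟩
    a 0 * (b (suc n) + c (suc n)) + (shift a ⊛ (b ⊕ c)) n
      ≡⟨ cong (_+_ (a 0 * (b (suc n) + c (suc n)))) (⊛-distribˡ-⊕ (shift a) b c n) ⟩
    a 0 * (b (suc n) + c (suc n)) + ((shift a ⊛ b) n + (shift a ⊛ c) n)
      ≡⟨ distrib (a 0) (b (suc n)) (c (suc n)) _ _ ⟩
    (a 0 * b (suc n) + (shift a ⊛ b) n) + (a 0 * c (suc n) + (shift a ⊛ c) n)
      ≡⟨ cong₂ _+_ (shift-⊛ a b n) (shift-⊛ a c n) ⟨
    (a ⊛ b) (suc n) + (a ⊛ c) (suc n) ∎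
    where distrib : ∀ x y z u v → x * (y + z) + (u + v) ≡ (x * y + u) + (x * z + v)
          distrib = solve-∀

  ⊛-·ˡ : ∀ x a b → (x · a) ⊛ b ≗ x · (a ⊛ b)
  ⊛-·ˡ x a b zero = assoc x (a 0) (b 0)
    where assoc : ∀ x y z → x * y * z + + 0 ≡ x * (y * z + + 0)
          assoc = solve-∀
  ⊛-·ˡ x a b (suc n) = begin
    ((x · a) ⊛ b) (suc n)                        ≡⟨ shift-⊛ (x · a) b n ⟩
    x * a 0 * b (suc n) + ((x · shift a) ⊛ b) n  ≡⟨ cong (_+_ (x * a 0 * b (suc n))) (⊛-·ˡ x (shift a) b n) ⟩
    x * a 0 * b (suc n) + x * (shift a ⊛ b) n    ≡⟨ assoc x (a 0) (b (suc n)) _ ⟩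
    x * (a 0 * b (suc n) + (shift a ⊛ b) n)      ≡⟨ cong (x *_) (shift-⊛ a b n) ⟨
    x * (a ⊛ b) (suc n)                          ∎
    where assoc : ∀ x y z u → x * y * z + x * u ≡ x * (y * z + u)
          assoc = solve-∀

  ⊛-·ʳ : ∀ x a b → a ⊛ (x · b) ≗ x · (a ⊛ b)
  ⊛-·ʳ x a b zero = assoc x (a 0) (b 0)
    where assoc : ∀ x y z → y * (x * z) + + 0 ≡ x * (y * z + + 0)
          assoc = solve-∀
  ⊛-·ʳ x a b (suc n) = begin
    (a ⊛ (x · b)) (suc n)
      ≡⟨ shift-⊛ a (x · b) n ⟩
    a 0 * (x * b (suc n)) + (shift a ⊛ (x · b)) n
      ≡⟨ cong (_+_ (a 0 * (x * b (suc n)))) (⊛-·ʳ x (shift a) b n) ⟩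
    a 0 * (x * b (suc n)) + x * (shift a ⊛ b) n
      ≡⟨ assoc x (a 0) (b (suc n)) _ ⟩
    x * (a 0 * b (suc n) + (shift a ⊛ b) n)
      ≡⟨ cong (x *_) (shift-⊛ a b n) ⟨
    x * (a ⊛ b) (suc n) ∎
    where assoc : ∀ x y z u → y * (x * z) + x * u ≡ x * (y * z + u)
          assoc = solve-∀

  ⊛-comm : ∀ a b → a ⊛ b ≗ b ⊛ a
  ⊛-comm a b n = comm n a b
    where
    comm : ∀ n a b → (a ⊛ b) n ≡ (b ⊛ a) n
    -- the instance at suc n is passed in so that the recursion of comm stays structural
    peel : ∀ n a b → (shift a ⊛ b) (suc n) ≡ (b ⊛ shift a) (suc n) →
           (a ⊛ b) (suc (suc n)) ≡ a 0 * b (suc (suc n)) + (b 0 * a (suc (suc n)) + (shift b ⊛ shift a) n)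
    swap : ∀ x y z → x + (y + z) ≡ y + (x + z)
    swap = solve-∀

    peel n a b comm′ = trans (shift-⊛ a b (suc n))
      (cong (_+_ (a 0 * b (suc (suc n)))) (trans comm′ (shift-⊛ b (shift a) n)))

    comm zero a b = cong (_+ + 0) (ℤ.*-comm (a 0) (b 0))
    comm (suc zero) a b = begin
      (a ⊛ b) 1                       ≡⟨ shift-⊛ a b 0 ⟩
      a 0 * b 1 + (a 1 * b 0 + + 0)   ≡⟨ swap₂ (a 0) (a 1) (b 0) (b 1) ⟩
      b 0 * a 1 + (b 1 * a 0 + + 0)   ≡⟨ shift-⊛ b a 0 ⟨
      (b ⊛ a) 1                       ∎
      where swap₂ : ∀ a₀ a₁ b₀ b₁ → a₀ * b₁ + (a₁ * b₀ + + 0) ≡ b₀ * a₁ + (b₁ * a₀ + + 0)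
            swap₂ = solve-∀
    comm (suc (suc n)) a b = begin
      (a ⊛ b) (suc (suc n))
        ≡⟨ peel n a b (comm (suc n) (shift a) b) ⟩
      a 0 * b (suc (suc n)) + (b 0 * a (suc (suc n)) + (shift b ⊛ shift a) n)
        ≡⟨ cong (λ s → a 0 * b (suc (suc n)) + (b 0 * a (suc (suc n)) + s)) (comm n (shift b) (shift a)) ⟩
      a 0 * b (suc (suc n)) + (b 0 * a (suc (suc n)) + (shift a ⊛ shift b) n)
        ≡⟨ swap (a 0 * b (suc (suc n))) (b 0 * a (suc (suc n))) _ ⟩
      b 0 * a (suc (suc n)) + (a 0 * b (suc (suc n)) + (shift a ⊛ shift b) n)
        ≡⟨ peel n b a (comm (suc n) (shift b) a) ⟨
      (b ⊛ a) (suc (suc n))                                                    ∎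

  ⊛-assoc : ∀ a b c → (a ⊛ b) ⊛ c ≗ a ⊛ (b ⊛ c)
  ⊛-assoc a b c zero = assoc (a 0) (b 0) (c 0)
    where assoc : ∀ x y z → (x * y + + 0) * z + + 0 ≡ x * (y * z + + 0) + + 0
          assoc = solve-∀
  ⊛-assoc a b c (suc n) = begin
    ((a ⊛ b) ⊛ c) (suc n)
      ≡⟨ shift-⊛ (a ⊛ b) c n ⟩
    (a 0 * b 0 + + 0) * c (suc n) + (shift (a ⊛ b) ⊛ c) n
      ≡⟨ cong (_+_ ((a 0 * b 0 + + 0) * c (suc n))) shift-ab⊛c ⟩
    (a 0 * b 0 + + 0) * c (suc n) + (a 0 * (shift b ⊛ c) n + (shift a ⊛ (b ⊛ c)) n)
      ≡⟨ assoc (a 0) (b 0) (c (suc n)) _ _ ⟩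
    a 0 * (b 0 * c (suc n) + (shift b ⊛ c) n) + (shift a ⊛ (b ⊛ c)) n
      ≡⟨ cong (λ s → a 0 * s + (shift a ⊛ (b ⊛ c)) n) (shift-⊛ b c n) ⟨
    a 0 * (b ⊛ c) (suc n) + (shift a ⊛ (b ⊛ c)) n
      ≡⟨ shift-⊛ a (b ⊛ c) n ⟨
    (a ⊛ (b ⊛ c)) (suc n)
      ∎
    where
    assoc : ∀ x y z u v → (x * y + + 0) * z + (x * u + v) ≡ x * (y * z + u) + v
    assoc = solve-∀
    shift-ab⊛c : (shift (a ⊛ b) ⊛ c) n ≡ a 0 * (shift b ⊛ c) n + (shift a ⊛ (b ⊛ c)) n
    shift-ab⊛c = begin
      (shift (a ⊛ b) ⊛ c) n
        ≡⟨ ⊛-congʳ c (shift-⊛ a b) n ⟩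
      (((a 0 · shift b) ⊕ (shift a ⊛ b)) ⊛ c) n
        ≡⟨ ⊛-distribʳ-⊕ (a 0 · shift b) (shift a ⊛ b) c n ⟩
      ((a 0 · shift b) ⊛ c) n + ((shift a ⊛ b) ⊛ c) n
        ≡⟨ cong₂ _+_ (⊛-·ˡ (a 0) (shift b) c n) (⊛-assoc (shift a) b c n) ⟩
      a 0 * (shift b ⊛ c) n + (shift a ⊛ (b ⊛ c)) n ∎

  ⊛-zeroʳ : ∀ a → a ⊛ zeroSeries ≗ zeroSeries
  ⊛-zeroʳ a n = trans (⊛-comm a zeroSeries n) (⊛-zeroˡ a n)

  ⊛-identityʳ : ∀ a → a ⊛ one ≗ a
  ⊛-identityʳ a n = trans (⊛-comm a one n) (⊛-identityˡ a n)

  ⊛-leftComm : ∀ a b c → a ⊛ (b ⊛ c) ≗ b ⊛ (a ⊛ c)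
  ⊛-leftComm a b c n = begin
    (a ⊛ (b ⊛ c)) n   ≡⟨ ⊛-assoc a b c n ⟨
    ((a ⊛ b) ⊛ c) n   ≡⟨ ⊛-congʳ c (⊛-comm a b) n ⟩
    ((b ⊛ a) ⊛ c) n   ≡⟨ ⊛-assoc b a c n ⟩
    (b ⊛ (a ⊛ c)) n   ∎

  shift-X : shift X ≗ one
  shift-X zero    = refl
  shift-X (suc n) = refl

  X⊛-suc : ∀ f n → (X ⊛ f) (suc n) ≡ f n
  X⊛-suc f n = begin
    (X ⊛ f) (suc n)                   ≡⟨ shift-⊛ X f n ⟩
    + 0 * f (suc n) + (shift X ⊛ f) n ≡⟨ ℤ.+-identityˡ _ ⟩
    (shift X ⊛ f) n                   ≡⟨ ⊛-congʳ f shift-X n ⟩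
    (one ⊛ f) n                       ≡⟨ ⊛-identityˡ f n ⟩
    f n                               ∎

  deriv-X⊛ : ∀ f n → deriv (X ⊛ f) n ≡ + suc n * f n
  deriv-X⊛ f n = cong (+ suc n *_) (X⊛-suc f n)

  θ : FPS → FPS
  θ a n = + n * a n

  shift-θ : ∀ a → shift (θ a) ≗ shift a ⊕ θ (shift a)
  shift-θ a n = distrib (+ n) (a (suc n))
    where distrib : ∀ m x → (+ 1 + m) * x ≡ x + m * x
          distrib = solve-∀

  θ-⊛ : ∀ a b → θ (a ⊛ b) ≗ (θ a ⊛ b) ⊕ (a ⊛ θ b)
  θ-⊛ a b zero = vanish (a 0) (b 0)
    where vanish : ∀ x y → + 0 * (x * y + + 0) ≡ (+ 0 * x) * y + + 0 + (x * (+ 0 * y) + + 0)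
          vanish = solve-∀
  θ-⊛ a b (suc n) = begin
    + suc n * (a ⊛ b) (suc n)
      ≡⟨ cong (+ suc n *_) (shift-⊛ a b n) ⟩
    + suc n * (a 0 * b (suc n) + s)
      ≡⟨ expand (+ n) (a 0) (b (suc n)) s ⟩
    a 0 * (+ suc n * b (suc n)) + (s + + n * s)
      ≡⟨ cong (λ r → a 0 * (+ suc n * b (suc n)) + (s + r)) (θ-⊛ (shift a) b n) ⟩
    a 0 * (+ suc n * b (suc n)) + (s + ((θ (shift a) ⊛ b) n + (shift a ⊛ θ b) n))
      ≡⟨ regroup (a 0) (b (suc n)) (a 0 * (+ suc n * b (suc n))) s _ _ ⟩
    (+ 0 * a 0 * b (suc n) + (s + (θ (shift a) ⊛ b) n)) + (a 0 * (+ suc n * b (suc n)) + (shift a ⊛ θ b) n)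
      ≡⟨ cong₂ _+_ θa⊛b (shift-⊛ a (θ b) n) ⟨
    (θ a ⊛ b) (suc n) + (a ⊛ θ b) (suc n)
      ∎
    where
    s : ℤ
    s = (shift a ⊛ b) n
    expand : ∀ m x y t → (+ 1 + m) * (x * y + t) ≡ x * ((+ 1 + m) * y) + (t + m * t)
    expand = solve-∀
    regroup : ∀ x y z t u v → z + (t + (u + v)) ≡ (+ 0 * x * y + (t + u)) + (z + v)
    regroup = solve-∀
    θa⊛b : (θ a ⊛ b) (suc n) ≡ + 0 * a 0 * b (suc n) + (s + (θ (shift a) ⊛ b) n)
    θa⊛b = trans (shift-⊛ (θ a) b n) (cong (_+_ (+ 0 * a 0 * b (suc n)))
      (trans (⊛-congʳ b (shift-θ a) n) (⊛-distribʳ-⊕ (shift a) (θ (shift a)) b n)))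

  θ-one : θ one ≗ zeroSeries
  θ-one zero    = refl
  θ-one (suc n) = ℤ.*-zeroʳ (+ suc n)

  θ-pow : ∀ a k → θ (pow a (suc k)) ≗ + suc k · (θ a ⊛ pow a k)
  θ-pow a zero n = begin
    θ (a ⊛ one) n                   ≡⟨ θ-⊛ a one n ⟩
    (θ a ⊛ one) n + (a ⊛ θ one) n   ≡⟨ cong (_+_ ((θ a ⊛ one) n)) (trans (⊛-congˡ a θ-one n) (⊛-zeroʳ a n)) ⟩
    (θ a ⊛ one) n + + 0             ≡⟨ ℤ.+-identityʳ _ ⟩
    (θ a ⊛ one) n                   ≡⟨ ℤ.*-identityˡ _ ⟨
    + 1 * (θ a ⊛ one) n             ∎
  θ-pow a (suc k) n = begin
    θ (a ⊛ pow a (suc k)) n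
      ≡⟨ θ-⊛ a (pow a (suc k)) n ⟩
    (θ a ⊛ pow a (suc k)) n + (a ⊛ θ (pow a (suc k))) n
      ≡⟨ cong (_+_ ((θ a ⊛ pow a (suc k)) n)) a⊛θaᵏ⁺¹ ⟩
    (θ a ⊛ pow a (suc k)) n + + suc k * (θ a ⊛ pow a (suc k)) n
      ≡⟨ collect (+ k) _ ⟩
    + suc (suc k) * (θ a ⊛ pow a (suc k)) n ∎
    where
    collect : ∀ m x → x + (+ 1 + m) * x ≡ (+ 1 + (+ 1 + m)) * x
    collect = solve-∀
    a⊛θaᵏ⁺¹ : (a ⊛ θ (pow a (suc k))) n ≡ + suc k * (θ a ⊛ pow a (suc k)) n
    a⊛θaᵏ⁺¹ = begin
      (a ⊛ θ (pow a (suc k))) n               ≡⟨ ⊛-congˡ a (θ-pow a k) n ⟩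
      (a ⊛ (+ suc k · (θ a ⊛ pow a k))) n     ≡⟨ ⊛-·ʳ (+ suc k) a (θ a ⊛ pow a k) n ⟩
      + suc k * (a ⊛ (θ a ⊛ pow a k)) n       ≡⟨ cong (+ suc k *_) (⊛-leftComm a (θ a) (pow a k) n) ⟩
      + suc k * (θ a ⊛ pow a (suc k)) n       ∎

  lookup-invVec : ∀ a n (j : Fin (suc n)) → lookup (invVec a n) j ≡ inv a (n ∸ toℕ j)
  lookup-invVec a zero    Fin.zero    = refl
  lookup-invVec a (suc n) Fin.zero    = refl
  lookup-invVec a (suc n) (Fin.suc j) = lookup-invVec a n j

  sumVℤ-lookup : ∀ {m} (v : Vec ℤ m) (h : ℕ → ℤ) → (∀ j → lookup v j ≡ h (toℕ j)) →
                 sumVℤ v ≡ sumℤ (applyUpTo h m)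
  sumVℤ-lookup []      h _  = refl
  sumVℤ-lookup (x ∷ v) h eq = cong₂ _+_ (eq Fin.zero) (sumVℤ-lookup v (h ∘ suc) (eq ∘ Fin.suc))

  inv-suc : ∀ a n → inv a (suc n) ≡ - (a 0 * (shift a ⊛ inv a) n)
  inv-suc a n = cong (λ s → - (a 0 * s))
    (trans (sumVℤ-lookup terms (λ k → a (suc k) * inv a (n ∸ k)) entry) (sym (⊛-coeff (shift a) (inv a) n)))
    where
    coeffs : Vec ℤ (suc n)
    coeffs = tabulate (λ j → a (suc (toℕ j)))
    terms : Vec ℤ (suc n)
    terms = zipWith _*_ coeffs (invVec a n)
    entry : ∀ j → lookup terms j ≡ a (suc (toℕ j)) * inv a (n ∸ toℕ j)
    entry j = trans (Vec.lookup-zipWith _*_ j coeffs (invVec a n))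
                    (cong₂ _*_ (Vec.lookup∘tabulate (λ j → a (suc (toℕ j))) j) (lookup-invVec a n j))

  ⊛-inverseʳ : ∀ a → a 0 * a 0 ≡ + 1 → a ⊛ inv a ≗ one
  ⊛-inverseʳ a unit zero    = trans (ℤ.+-identityʳ _) unit
  ⊛-inverseʳ a unit (suc n) = begin
    (a ⊛ inv a) (suc n)       ≡⟨ shift-⊛ a (inv a) n ⟩
    a 0 * inv a (suc n) + s   ≡⟨ cong (λ r → a 0 * r + s) (inv-suc a n) ⟩
    a 0 * - (a 0 * s) + s     ≡⟨ factor (a 0) s ⟩
    (+ 1 - a 0 * a 0) * s     ≡⟨ cong (λ u → (+ 1 - u) * s) unit ⟩
    (+ 1 - + 1) * s           ≡⟨ vanish s ⟩
    + 0                       ∎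
    where
    s : ℤ
    s = (shift a ⊛ inv a) n
    factor : ∀ x t → x * - (x * t) + t ≡ (+ 1 - x * x) * t
    factor = solve-∀
    vanish : ∀ t → (+ 1 - + 1) * t ≡ + 0
    vanish = solve-∀

  ⊛-inv-cancel : ∀ q p e → q 0 * q 0 ≡ + 1 → q ⊛ p ≗ e → e ⊛ inv q ≗ p
  ⊛-inv-cancel q p e unit q⊛p≗e n = begin
    (e ⊛ inv q) n           ≡⟨ ⊛-congʳ (inv q) (λ m → trans (sym (q⊛p≗e m)) (⊛-comm q p m)) n ⟩
    ((p ⊛ q) ⊛ inv q) n     ≡⟨ ⊛-assoc p q (inv q) n ⟩
    (p ⊛ (q ⊛ inv q)) n     ≡⟨ ⊛-congˡ p (⊛-inverseʳ q unit) n ⟩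
    (p ⊛ one) n             ≡⟨ ⊛-identityʳ p n ⟩
    p n                     ∎

  inv-unique : ∀ q p → q 0 * q 0 ≡ + 1 → q ⊛ p ≗ one → inv q ≗ p
  inv-unique q p unit q⊛p≗one n = trans (sym (⊛-identityˡ (inv q) n)) (⊛-inv-cancel q p one unit q⊛p≗one n)

  pow-cong : ∀ {a b} k → a ≗ b → pow a k ≗ pow b k
  pow-cong zero    a≗b n = refl
  pow-cong (suc k) a≗b   = ⊛-cong a≗b (pow-cong k a≗b)

  pow-unit : ∀ a k → a 0 ≡ + 1 → pow a k 0 * pow a k 0 ≡ + 1
  pow-unit a k a₀≡1 = cong (λ x → x * x) (pow-head k)
    where pow-head : ∀ k → pow a k 0 ≡ + 1
          pow-head zero    = refl
          pow-head (suc k) = cong₂ (λ x y → x * y + + 0) a₀≡1 (pow-head k)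

  shift-negArg : ∀ a → shift (negArg a) ≗ -1ℤ · negArg (shift a)
  shift-negArg a n = ℤ.*-assoc -1ℤ (-1ℤ ^ n) (a (suc n))

  negArg-cong : ∀ {a b} → a ≗ b → negArg a ≗ negArg b
  negArg-cong a≗b n = cong (-1ℤ ^ n *_) (a≗b n)

  negArg-⊛ : ∀ a b → negArg (a ⊛ b) ≗ negArg a ⊛ negArg b
  negArg-⊛ a b zero = unsigned (a 0) (b 0)
    where unsigned : ∀ x y → + 1 * (x * y + + 0) ≡ + 1 * x * (+ 1 * y) + + 0
          unsigned = solve-∀
  negArg-⊛ a b (suc n) = begin
    -1ℤ * s * (a ⊛ b) (suc n)
      ≡⟨ cong (-1ℤ * s *_) (shift-⊛ a b n) ⟩
    -1ℤ * s * (a 0 * b (suc n) + (shift a ⊛ b) n)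
      ≡⟨ distrib s (a 0) (b (suc n)) _ ⟩
    + 1 * a 0 * (-1ℤ * s * b (suc n)) + -1ℤ * (s * (shift a ⊛ b) n)
      ≡⟨ cong (λ r → + 1 * a 0 * (-1ℤ * s * b (suc n)) + -1ℤ * r) (negArg-⊛ (shift a) b n) ⟩
    + 1 * a 0 * (-1ℤ * s * b (suc n)) + -1ℤ * (negArg (shift a) ⊛ negArg b) n
      ≡⟨ cong (_+_ (+ 1 * a 0 * (-1ℤ * s * b (suc n)))) shifted ⟩
    + 1 * a 0 * (-1ℤ * s * b (suc n)) + (shift (negArg a) ⊛ negArg b) n
      ≡⟨ shift-⊛ (negArg a) (negArg b) n ⟨
    (negArg a ⊛ negArg b) (suc n) ∎
    where
    s : ℤ
    s = -1ℤ ^ n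
    distrib : ∀ s x y t → -1ℤ * s * (x * y + t) ≡ + 1 * x * (-1ℤ * s * y) + -1ℤ * (s * t)
    distrib = solve-∀
    shifted : -1ℤ * (negArg (shift a) ⊛ negArg b) n ≡ (shift (negArg a) ⊛ negArg b) n
    shifted = trans (sym (⊛-·ˡ -1ℤ (negArg (shift a)) (negArg b) n))
                    (⊛-congʳ (negArg b) (λ m → sym (shift-negArg a m)) n)

  deriv-X⊛-negArg : ∀ f → deriv (X ⊛ negArg f) ≗ negArg (deriv (X ⊛ f))
  deriv-X⊛-negArg f n = begin
    deriv (X ⊛ negArg f) n       ≡⟨ deriv-X⊛ (negArg f) n ⟩
    + suc n * (-1ℤ ^ n * f n)    ≡⟨ commute (+ suc n) (-1ℤ ^ n) (f n) ⟩
    -1ℤ ^ n * (+ suc n * f n)    ≡⟨ cong (-1ℤ ^ n *_) (deriv-X⊛ f n) ⟨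
    negArg (deriv (X ⊛ f)) n     ∎
    where commute : ∀ a s x → a * (s * x) ≡ s * (a * x)
          commute = solve-∀

  negArg-one : negArg one ≗ one
  negArg-one zero    = refl
  negArg-one (suc n) = ℤ.*-zeroʳ (-1ℤ ^ suc n)

  negArg-pow : ∀ a k → negArg (pow a k) ≗ pow (negArg a) k
  negArg-pow a zero    = negArg-one
  negArg-pow a (suc k) n = trans (negArg-⊛ a (pow a k) n) (⊛-congˡ (negArg a) (negArg-pow a k) n)

module EulerianGeneratingFunction where

  open import Data.Nat using (ℕ; zero; suc)
  open import Data.Integer using (ℤ; +_; _+_; _*_; -_; _-_; -1ℤ; _^_)
  import Data.Integer.Properties as ℤ
  open import Data.Integer.Tactic.RingSolver using (solve-∀)
  open import Relation.Binary.PropositionalEquality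
  open ≡-Reasoning
  open PowerSeries

  sucPow : ℕ → FPS
  sucPow i n = (+ suc n) ^ i

  sucPow-suc : ∀ i → sucPow (suc i) ≗ sucPow i ⊕ θ (sucPow i)
  sucPow-suc i n = distrib (+ n) (sucPow i n)
    where distrib : ∀ m x → (+ 1 + m) * x ≡ x + m * x
          distrib = solve-∀

  deriv-X⊛-sucPow : ∀ i → deriv (X ⊛ sucPow i) ≗ sucPow (suc i)
  deriv-X⊛-sucPow i = deriv-X⊛ (sucPow i)

  deriv-X⊛-negArg-sucPow : ∀ i → deriv (X ⊛ negArg (sucPow i)) ≗ negArg (sucPow (suc i))
  deriv-X⊛-negArg-sucPow i n = trans (deriv-X⊛-negArg (sucPow i) n) (negArg-cong (deriv-X⊛-sucPow i) n)

  shift-oneMinusT : shift oneMinusT ≗ -1ℤ · one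
  shift-oneMinusT zero    = refl
  shift-oneMinusT (suc n) = refl

  oneMinusT⊛-suc : ∀ f k → (oneMinusT ⊛ f) (suc k) ≡ f (suc k) - f k
  oneMinusT⊛-suc f k = begin
    (oneMinusT ⊛ f) (suc k)                        ≡⟨ shift-⊛ oneMinusT f k ⟩
    + 1 * f (suc k) + (shift oneMinusT ⊛ f) k      ≡⟨ cong (_+_ (+ 1 * f (suc k))) shifted ⟩
    + 1 * f (suc k) + -1ℤ * f k                    ≡⟨ difference (f (suc k)) (f k) ⟩
    f (suc k) - f k                                ∎
    where
    difference : ∀ x y → + 1 * x + -1ℤ * y ≡ x - y
    difference = solve-∀
    shifted : (shift oneMinusT ⊛ f) k ≡ -1ℤ * f k
    shifted = trans (⊛-congʳ f shift-oneMinusT k)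
                    (trans (⊛-·ˡ -1ℤ one f k) (cong (-1ℤ *_) (⊛-identityˡ f k)))

  oneMinusT⊛sucPow₀ : oneMinusT ⊛ sucPow 0 ≗ one
  oneMinusT⊛sucPow₀ zero    = refl
  oneMinusT⊛sucPow₀ (suc k) = oneMinusT⊛-suc (sucPow 0) k

  θ-oneMinusT : θ oneMinusT ≗ -1ℤ · X
  θ-oneMinusT zero          = refl
  θ-oneMinusT (suc zero)    = refl
  θ-oneMinusT (suc (suc k)) = ℤ.*-zeroʳ (+ suc (suc k))

  negArg-oneMinusT : negArg oneMinusT ≗ onePlusT
  negArg-oneMinusT zero          = refl
  negArg-oneMinusT (suc zero)    = refl
  negArg-oneMinusT (suc (suc k)) = ℤ.*-zeroʳ (-1ℤ ^ suc (suc k))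

  pow-onePlusT-⊛-negArg : ∀ k f → pow onePlusT k ⊛ negArg f ≗ negArg (pow oneMinusT k ⊛ f)
  pow-onePlusT-⊛-negArg k f n = begin
    (pow onePlusT k ⊛ negArg f) n
      ≡⟨ ⊛-congʳ (negArg f) (pow-cong k (λ m → sym (negArg-oneMinusT m))) n ⟩
    (pow (negArg oneMinusT) k ⊛ negArg f) n
      ≡⟨ ⊛-congʳ (negArg f) (negArg-pow oneMinusT k) n ⟨
    (negArg (pow oneMinusT k) ⊛ negArg f) n
      ≡⟨ negArg-⊛ (pow oneMinusT k) f n ⟨
    negArg (pow oneMinusT k ⊛ f) n ∎

  -- Leibniz: (1-t)^(k+2) θ f = θ((1-t) e) − θ((1-t)^(k+2)) f, and θ((1-t)^(k+2)) = −(k+2) t (1-t)^(k+1).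
  pow-oneMinusT-⊛-1+θ : ∀ k f e → pow oneMinusT (suc k) ⊛ f ≗ e → ∀ n →
    (pow oneMinusT (suc (suc k)) ⊛ (f ⊕ θ f)) n
      ≡ (oneMinusT ⊛ e) n + + n * (oneMinusT ⊛ e) n + + suc (suc k) * (X ⊛ e) n
  pow-oneMinusT-⊛-1+θ k f e eq n = begin
    (M² ⊛ (f ⊕ θ f)) n                      ≡⟨ ⊛-distribˡ-⊕ M² f (θ f) n ⟩
    (M² ⊛ f) n + (M² ⊛ θ f) n               ≡⟨ cong₂ _+_ (M²⊛f n) M²⊛θf ⟩
    (M ⊛ e) n + (+ n * (M ⊛ e) n + c * (X ⊛ e) n) ≡⟨ ℤ.+-assoc ((M ⊛ e) n) _ _ ⟨
    (M ⊛ e) n + + n * (M ⊛ e) n + c * (X ⊛ e) n   ∎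
    where
    M M¹ M² : FPS
    M = oneMinusT
    M¹ = pow M (suc k)
    M² = pow M (suc (suc k))
    c : ℤ
    c = + suc (suc k)
    M²⊛f : M² ⊛ f ≗ M ⊛ e
    M²⊛f m = trans (⊛-assoc M M¹ f m) (⊛-congˡ M eq m)
    θM²⊛f : (θ M² ⊛ f) n ≡ - (c * (X ⊛ e) n)
    θM²⊛f = begin
      (θ M² ⊛ f) n                 ≡⟨ ⊛-congʳ f (θ-pow M (suc k)) n ⟩
      ((c · (θ M ⊛ M¹)) ⊛ f) n     ≡⟨ ⊛-·ˡ c (θ M ⊛ M¹) f n ⟩
      c * ((θ M ⊛ M¹) ⊛ f) n       ≡⟨ cong (c *_) (trans (⊛-assoc (θ M) M¹ f n) (⊛-congˡ (θ M) eq n)) ⟩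
      c * (θ M ⊛ e) n              ≡⟨ cong (c *_) (trans (⊛-congʳ e θ-oneMinusT n) (⊛-·ˡ -1ℤ X e n)) ⟩
      c * (-1ℤ * (X ⊛ e) n)        ≡⟨ negate c _ ⟩
      - (c * (X ⊛ e) n)            ∎
      where negate : ∀ c x → c * (-1ℤ * x) ≡ - (c * x)
            negate = solve-∀
    leibniz : + n * (M ⊛ e) n ≡ (θ M² ⊛ f) n + (M² ⊛ θ f) n
    leibniz = trans (cong (+ n *_) (sym (M²⊛f n))) (θ-⊛ M² f n)
    M²⊛θf : (M² ⊛ θ f) n ≡ + n * (M ⊛ e) n + c * (X ⊛ e) n
    M²⊛θf = begin
      (M² ⊛ θ f) n                                   ≡⟨ cancel ((θ M² ⊛ f) n) _ ⟩
      (θ M² ⊛ f) n + (M² ⊛ θ f) n - (θ M² ⊛ f) n     ≡⟨ cong₂ _-_ (sym leibniz) θM²⊛f ⟩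
      + n * (M ⊛ e) n - - (c * (X ⊛ e) n)            ≡⟨ cong (_+_ (+ n * (M ⊛ e) n)) (ℤ.neg-involutive _) ⟩
      + n * (M ⊛ e) n + c * (X ⊛ e) n                ∎
      where cancel : ∀ u v → v ≡ u + v - u
            cancel = solve-∀

  record EulerianRecurrence (E : ℕ → FPS) : Set where
    field
      initial  : E 0 ≗ one
      constant : ∀ i → E (suc i) 0 ≡ E i 0
      step     : ∀ i k → E (suc i) (suc k) ≡ + suc (suc k) * E i (suc k) + (+ i - + k) * E i k

  module _ {E : ℕ → FPS} (rec : EulerianRecurrence E) where
    open EulerianRecurrence rec

    series-recurrence : ∀ i n →
      (oneMinusT ⊛ E i) n + + n * (oneMinusT ⊛ E i) n + + suc (suc i) * (X ⊛ E i) n ≡ E (suc i) n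
    series-recurrence i zero = begin
      (oneMinusT ⊛ E i) 0 + + 0 * (oneMinusT ⊛ E i) 0 + + suc (suc i) * + 0
        ≡⟨ drop ((oneMinusT ⊛ E i) 0) ((oneMinusT ⊛ E i) 0) (+ suc (suc i)) ⟩
      (oneMinusT ⊛ E i) 0
        ≡⟨ ⊛-identityˡ (E i) 0 ⟩
      E i 0
        ≡⟨ constant i ⟨
      E (suc i) 0 ∎
      where drop : ∀ x y c → x + + 0 * y + c * + 0 ≡ x
            drop = solve-∀
    series-recurrence i (suc k) = begin
      (oneMinusT ⊛ E i) (suc k) + + suc k * (oneMinusT ⊛ E i) (suc k) + + suc (suc i) * (X ⊛ E i) (suc k)
        ≡⟨ cong₂ (λ u v → u + + suc k * u + + suc (suc i) * v) (oneMinusT⊛-suc (E i) k) (X⊛-suc (E i) k) ⟩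
      E i (suc k) - E i k + + suc k * (E i (suc k) - E i k) + + suc (suc i) * E i k
        ≡⟨ collect (+ k) (+ i) (E i (suc k)) (E i k) ⟩
      + suc (suc k) * E i (suc k) + (+ i - + k) * E i k
        ≡⟨ step i k ⟨
      E (suc i) (suc k) ∎
      where collect : ∀ k i x y → x - y + (+ 1 + k) * (x - y) + (+ 1 + (+ 1 + i)) * y
                                  ≡ (+ 1 + (+ 1 + k)) * x + (i - k) * y
            collect = solve-∀

    carlitz : ∀ i → pow oneMinusT (suc i) ⊛ sucPow i ≗ E i
    carlitz zero n = begin
      ((oneMinusT ⊛ one) ⊛ sucPow 0) n   ≡⟨ ⊛-congʳ (sucPow 0) (⊛-identityʳ oneMinusT) n ⟩
      (oneMinusT ⊛ sucPow 0) n           ≡⟨ oneMinusT⊛sucPow₀ n ⟩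
      one n                              ≡⟨ initial n ⟨
      E 0 n                              ∎
    carlitz (suc i) n = begin
      (pow oneMinusT (suc (suc i)) ⊛ sucPow (suc i)) n
        ≡⟨ ⊛-congˡ (pow oneMinusT (suc (suc i))) (sucPow-suc i) n ⟩
      (pow oneMinusT (suc (suc i)) ⊛ (sucPow i ⊕ θ (sucPow i))) n
        ≡⟨ pow-oneMinusT-⊛-1+θ i (sucPow i) (E i) (carlitz i) n ⟩
      (oneMinusT ⊛ E i) n + + n * (oneMinusT ⊛ E i) n + + suc (suc i) * (X ⊛ E i) n
        ≡⟨ series-recurrence i n ⟩
      E (suc i) n ∎

    eulerian-quotient : ∀ i → E i ⊛ inv (pow oneMinusT (suc i)) ≗ sucPow i
    eulerian-quotient i = ⊛-inv-cancel _ _ _ (pow-unit oneMinusT (suc i) refl) (carlitz i)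

    eulerian-quotient-negArg : ∀ i → negArg (E i) ⊛ inv (pow onePlusT (suc i)) ≗ negArg (sucPow i)
    eulerian-quotient-negArg i = ⊛-inv-cancel _ _ _ (pow-unit onePlusT (suc i) refl)
      (λ n → trans (pow-onePlusT-⊛-negArg (suc i) (sucPow i) n) (negArg-cong (carlitz i) n))

  inv-oneMinusT : inv oneMinusT ≗ sucPow 0
  inv-oneMinusT = inv-unique oneMinusT (sucPow 0) refl oneMinusT⊛sucPow₀

  inv-onePlusT : inv onePlusT ≗ negArg (sucPow 0)
  inv-onePlusT = inv-unique onePlusT (negArg (sucPow 0)) refl λ n → begin
    (onePlusT ⊛ negArg (sucPow 0)) n
      ≡⟨ ⊛-congʳ (negArg (sucPow 0)) (λ m → sym (negArg-oneMinusT m)) n ⟩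
    (negArg oneMinusT ⊛ negArg (sucPow 0)) n
      ≡⟨ negArg-⊛ oneMinusT (sucPow 0) n ⟨
    negArg (oneMinusT ⊛ sucPow 0) n
      ≡⟨ negArg-cong oneMinusT⊛sucPow₀ n ⟩
    negArg one n
      ≡⟨ negArg-one n ⟩
    one n ∎

module Permutations where

  open import Data.Nat as ℕ using (ℕ; zero; suc; _≤_; _<_; z≤n; s≤s; _≟_)
  import Data.Nat.Properties as ℕ
  open import Data.Bool using (T)
  open import Data.Empty using (⊥; ⊥-elim)
  open import Data.List using (List; []; _∷_; _++_; length; map; upTo; applyUpTo; concatMap)
  import Data.List.Properties as List
  open import Data.List.Membership.Propositional using (_∈_; _∉_)
  import Data.List.Membership.Propositional.Properties as ∈
  open import Data.List.Membership.Propositional.Properties.WithK using (unique∧set⇒bag)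
  open import Data.List.Relation.Binary.BagAndSetEquality using (∼bag⇒↭)
  open import Data.List.Relation.Binary.Permutation.Propositional using (_↭_)
  open import Data.List.Relation.Unary.Any as Any using (here; there)
  open import Data.List.Relation.Unary.Any.Properties using (any⁺; any⁻)
  open import Data.List.Relation.Unary.All as All using (All; []; _∷_)
  open import Data.List.Relation.Unary.All.Properties using (all⁺; all⁻)
  open import Data.List.Relation.Unary.AllPairs using ([]; _∷_)
  open import Data.List.Relation.Unary.Unique.Propositional using (Unique)
  import Data.List.Relation.Unary.Unique.Propositional.Properties as Unique
  open import Data.Product using (_×_; _,_; ∃-syntax)
  open import Data.Sum using (_⊎_; inj₁; inj₂; [_,_]′)
  open import Function using (_∘_; mk⇔)
  open import Relation.Nullary.Decidable using (yes; no; T?)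
  open import Relation.Binary.PropositionalEquality

  range : ℕ → List ℕ
  range n = map suc (upTo n)

  insertAt : ℕ → ℕ → List ℕ → List ℕ
  insertAt zero    x w       = x ∷ w
  insertAt (suc p) x []      = x ∷ []
  insertAt (suc p) x (y ∷ w) = y ∷ insertAt p x w

  delete : ℕ → List ℕ → List ℕ
  delete x []      = []
  delete x (y ∷ w) with y ≟ x
  ... | yes _ = w
  ... | no  _ = y ∷ delete x w

  position : ℕ → List ℕ → ℕ
  position x []      = 0
  position x (y ∷ w) with y ≟ x
  ... | yes _ = 0
  ... | no  _ = suc (position x w)

  ∈-delete⁺ : ∀ {z y} w → z ∈ w → z ≢ y → z ∈ delete y w
  ∈-delete⁺ {y = y} (a ∷ w) z∈ z≢y with a ≟ y
  ∈-delete⁺ (a ∷ w) (here z≡a)  z≢y | yes a≡y = ⊥-elim (z≢y (trans z≡a a≡y))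
  ∈-delete⁺ (a ∷ w) (there z∈)  z≢y | yes _   = z∈
  ∈-delete⁺ (a ∷ w) (here z≡a)  z≢y | no  _   = here z≡a
  ∈-delete⁺ (a ∷ w) (there z∈)  z≢y | no  _   = there (∈-delete⁺ w z∈ z≢y)

  ∈-delete⁻ : ∀ {z y} w → z ∈ delete y w → z ∈ w
  ∈-delete⁻ {y = y} (a ∷ w) z∈ with a ≟ y
  ∈-delete⁻ (a ∷ w) z∈          | yes _ = there z∈
  ∈-delete⁻ (a ∷ w) (here z≡a)  | no  _ = here z≡a
  ∈-delete⁻ (a ∷ w) (there z∈)  | no  _ = there (∈-delete⁻ w z∈)

  length-delete : ∀ {y} w → y ∈ w → suc (length (delete y w)) ≡ length w
  length-delete {y} (a ∷ w) y∈ with a ≟ y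
  length-delete (a ∷ w) y∈          | yes _   = refl
  length-delete (a ∷ w) (here y≡a)  | no  a≢y = ⊥-elim (a≢y (sym y≡a))
  length-delete (a ∷ w) (there y∈)  | no  _   = cong suc (length-delete w y∈)

  position≤length-delete : ∀ {x} w → x ∈ w → position x w ≤ length (delete x w)
  position≤length-delete {x} (a ∷ w) x∈ with a ≟ x
  position≤length-delete (a ∷ w) x∈          | yes _   = z≤n
  position≤length-delete (a ∷ w) (here x≡a)  | no  a≢x = ⊥-elim (a≢x (sym x≡a))
  position≤length-delete (a ∷ w) (there x∈)  | no  _   = s≤s (position≤length-delete w x∈)

  insertAt-position-delete : ∀ {x} w → x ∈ w → insertAt (position x w) x (delete x w) ≡ w
  insertAt-position-delete {x} (a ∷ w) x∈ with a ≟ x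
  insertAt-position-delete (a ∷ w) x∈          | yes a≡x = cong (_∷ w) (sym a≡x)
  insertAt-position-delete (a ∷ w) (here x≡a)  | no  a≢x = ⊥-elim (a≢x (sym x≡a))
  insertAt-position-delete (a ∷ w) (there x∈)  | no  _   = cong (a ∷_) (insertAt-position-delete w x∈)

  delete-insertAt : ∀ {x} p σ → x ∉ σ → delete x (insertAt p x σ) ≡ σ
  delete-insertAt {x} zero σ x∉ with x ≟ x
  ... | yes _   = refl
  ... | no  x≢x = ⊥-elim (x≢x refl)
  delete-insertAt {x} (suc p) [] x∉ with x ≟ x
  ... | yes _   = refl
  ... | no  x≢x = ⊥-elim (x≢x refl)
  delete-insertAt {x} (suc p) (y ∷ σ) x∉ with y ≟ x
  ... | yes y≡x = ⊥-elim (x∉ (here (sym y≡x)))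
  ... | no  _   = cong (y ∷_) (delete-insertAt p σ (x∉ ∘ there))

  position-insertAt : ∀ {x} p σ → x ∉ σ → p ≤ length σ → position x (insertAt p x σ) ≡ p
  position-insertAt {x} zero σ x∉ _ with x ≟ x
  ... | yes _   = refl
  ... | no  x≢x = ⊥-elim (x≢x refl)
  position-insertAt {x} (suc p) (y ∷ σ) x∉ (s≤s p≤) with y ≟ x
  ... | yes y≡x = ⊥-elim (x∉ (here (sym y≡x)))
  ... | no  _   = cong suc (position-insertAt p σ (x∉ ∘ there) p≤)

  length-insertAt : ∀ p x σ → length (insertAt p x σ) ≡ suc (length σ)
  length-insertAt zero    x σ       = refl
  length-insertAt (suc p) x []      = refl
  length-insertAt (suc p) x (y ∷ σ) = cong suc (length-insertAt p x σ)

  ∈-insertAt⁻ : ∀ {z} p x σ → z ∈ insertAt p x σ → z ≡ x ⊎ z ∈ σ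
  ∈-insertAt⁻ zero    x σ       (here z≡x) = inj₁ z≡x
  ∈-insertAt⁻ zero    x σ       (there z∈) = inj₂ z∈
  ∈-insertAt⁻ (suc p) x []      (here z≡x) = inj₁ z≡x
  ∈-insertAt⁻ (suc p) x (y ∷ σ) (here z≡y) = inj₂ (here z≡y)
  ∈-insertAt⁻ (suc p) x (y ∷ σ) (there z∈) with ∈-insertAt⁻ p x σ z∈
  ... | inj₁ z≡x = inj₁ z≡x
  ... | inj₂ z∈σ = inj₂ (there z∈σ)

  x∈insertAt : ∀ p x σ → x ∈ insertAt p x σ
  x∈insertAt zero    x σ       = here refl
  x∈insertAt (suc p) x []      = here refl
  x∈insertAt (suc p) x (y ∷ σ) = there (x∈insertAt p x σ)

  ∈-insertAt⁺ : ∀ {z} p x σ → z ∈ σ → z ∈ insertAt p x σ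
  ∈-insertAt⁺ zero    x σ       z∈         = there z∈
  ∈-insertAt⁺ (suc p) x (y ∷ σ) (here z≡y) = here z≡y
  ∈-insertAt⁺ (suc p) x (y ∷ σ) (there z∈) = there (∈-insertAt⁺ p x σ z∈)

  unique-⊆⇒length≤ : ∀ {ys} xs → Unique ys → (∀ {z} → z ∈ ys → z ∈ xs) → length ys ≤ length xs
  unique-⊆⇒length≤ {[]}     xs _          _  = z≤n
  unique-⊆⇒length≤ {y ∷ ys} xs (y∉ys ∷ u) ⊆xs =
    subst (suc (length ys) ≤_) (length-delete xs (⊆xs (here refl)))
      (s≤s (unique-⊆⇒length≤ (delete y xs) u
        (λ z∈ys → ∈-delete⁺ xs (⊆xs (there z∈ys)) (λ z≡y → All.lookup y∉ys z∈ys (sym z≡y)))))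

  concatMap-unique : ∀ {A B : Set} (f : A → List B) {xs} → Unique xs →
                     (∀ {a} → a ∈ xs → Unique (f a)) →
                     (∀ {a b c} → a ∈ xs → b ∈ xs → c ∈ f a → c ∈ f b → a ≡ b) →
                     Unique (concatMap f xs)
  concatMap-unique f {[]}     _           _      _        = []
  concatMap-unique f {x ∷ xs} (x∉xs ∷ u) unique disjoint =
    Unique.++⁺ (unique (here refl))
               (concatMap-unique f u (unique ∘ there) (λ a∈ b∈ → disjoint (there a∈) (there b∈)))
               (λ (c∈fx , c∈rest) → separate c∈fx c∈rest)
    where
    separate : ∀ {c} → c ∈ f x → c ∈ concatMap f xs → ⊥
    separate c∈fx c∈rest with ∈.∈-concat⁻′ (map f xs) c∈rest
    ... | ys , c∈ys , ys∈ with ∈.∈-map⁻ f ys∈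
    ... | b , b∈ , refl = All.lookup x∉xs b∈ (disjoint (here refl) (there b∈) c∈fx c∈ys)

  ∈-range⁻ : ∀ {z n} → z ∈ range n → ∃[ y ] z ≡ suc y × y < n
  ∈-range⁻ z∈ with ∈.∈-map⁻ suc z∈
  ... | y , y∈ , z≡ = y , z≡ , ∈.∈-upTo⁻ y∈

  ∈-range⁺ : ∀ {y n} → y < n → suc y ∈ range n
  ∈-range⁺ y< = ∈.∈-map⁺ suc (∈.∈-upTo⁺ y<)

  ∈-range⇒≤ : ∀ {z n} → z ∈ range n → z ≤ n
  ∈-range⇒≤ z∈ with ∈-range⁻ z∈
  ... | y , refl , y< = y<

  ∈-range-suc⁺ : ∀ {z n} → z ∈ range n → z ∈ range (suc n)
  ∈-range-suc⁺ z∈ with ∈-range⁻ z∈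
  ... | y , refl , y< = ∈-range⁺ (ℕ.m<n⇒m<1+n y<)

  ∈-range-suc⁻ : ∀ {z n} → z ∈ range (suc n) → z ≡ suc n ⊎ z ∈ range n
  ∈-range-suc⁻ z∈ with ∈-range⁻ z∈
  ... | y , refl , y< with ℕ.m<1+n⇒m<n∨m≡n y<
  ...   | inj₁ y<n  = inj₂ (∈-range⁺ y<n)
  ...   | inj₂ refl = inj₁ refl

  suc∈range-suc : ∀ n → suc n ∈ range (suc n)
  suc∈range-suc n = ∈-range⁺ (ℕ.n<1+n n)

  length-range : ∀ n → length (range n) ≡ n
  length-range n = trans (List.length-map suc (upTo n)) (List.length-upTo n)

  range-unique : ∀ n → Unique (range n)
  range-unique n = Unique.map⁺ ℕ.suc-injective (Unique.upTo⁺ n)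

  extensions : ℕ → List ℕ → List (List ℕ)
  extensions n w = map (_∷ w) (range n)

  ∈-words⁻ : ∀ m n {w} → w ∈ words m n → length w ≡ m × (∀ {z} → z ∈ w → z ∈ range n)
  ∈-words⁻ zero    n (here refl) = refl , λ ()
  ∈-words⁻ (suc m) n w∈ with ∈.∈-concat⁻′ (map (extensions n) (words m n)) w∈
  ... | ws , w∈ws , ws∈ with ∈.∈-map⁻ (extensions n) ws∈
  ... | v , v∈ , refl with ∈.∈-map⁻ (_∷ v) w∈ws
  ... | x , x∈ , refl with ∈-words⁻ m n v∈
  ... | length≡ , ⊆range = cong suc length≡ , λ { (here refl) → x∈ ; (there z∈) → ⊆range z∈ }

  ∈-words⁺ : ∀ m n {w} → length w ≡ m → (∀ {z} → z ∈ w → z ∈ range n) → w ∈ words m n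
  ∈-words⁺ zero    n {[]}    _       _      = here refl
  ∈-words⁺ (suc m) n {x ∷ w} length≡ ⊆range =
    ∈.∈-concat⁺′ (∈.∈-map⁺ (_∷ w) (⊆range (here refl)))
                 (∈.∈-map⁺ (extensions n) (∈-words⁺ m n (ℕ.suc-injective length≡) (⊆range ∘ there)))

  words-unique : ∀ m n → Unique (words m n)
  words-unique zero    n = [] ∷ []
  words-unique (suc m) n = concatMap-unique (extensions n) (words-unique m n)
    (λ _ → Unique.map⁺ List.∷-injectiveˡ (range-unique n)) same-tail
    where
    same-tail : ∀ {a b c} → a ∈ words m n → b ∈ words m n → c ∈ extensions n a → c ∈ extensions n b → a ≡ b
    same-tail {a} {b} _ _ c∈a c∈b with ∈.∈-map⁻ (_∷ a) c∈a | ∈.∈-map⁻ (_∷ b) c∈b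
    ... | _ , _ , refl | _ , _ , eq = List.∷-injectiveʳ eq

  record IsPermutation (n : ℕ) (w : List ℕ) : Set where
    field
      length≡ : length w ≡ n
      ⊆range  : ∀ {z} → z ∈ w → z ∈ range n
      range⊆  : ∀ {j} → j ∈ range n → j ∈ w
  open IsPermutation

  elemᵇ⁻ : ∀ {j w} → T (elemᵇ j w) → j ∈ w
  elemᵇ⁻ {j} {w} t = Any.map (λ {x} x≡ᵇj → sym (ℕ.≡ᵇ⇒≡ x j x≡ᵇj)) (any⁻ _ w t)

  elemᵇ⁺ : ∀ {j w} → j ∈ w → T (elemᵇ j w)
  elemᵇ⁺ {j} j∈ = any⁺ _ (Any.map (λ {x} j≡x → ℕ.≡⇒≡ᵇ x j (sym j≡x)) j∈)

  ∈-perms⁻ : ∀ {n w} → w ∈ perms n → IsPermutation n w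
  ∈-perms⁻ {n} {w} w∈ with ∈.∈-filter⁻ (T? ∘ isPerm n) w∈
  ... | w∈words , all-in with ∈-words⁻ n n w∈words
  ... | length≡ , ⊆range = record
    { length≡ = length≡
    ; ⊆range  = ⊆range
    ; range⊆  = λ j∈ → elemᵇ⁻ (All.lookup (all⁺ _ (range n) all-in) j∈)
    }

  ∈-perms⁺ : ∀ {n w} → IsPermutation n w → w ∈ perms n
  ∈-perms⁺ {n} {w} π = ∈.∈-filter⁺ (T? ∘ isPerm n) (∈-words⁺ n n (length≡ π) (⊆range π))
    (all⁻ (λ j → elemᵇ j w) (All.tabulate (elemᵇ⁺ ∘ range⊆ π)))

  perms-unique : ∀ n → Unique (perms n)
  perms-unique n = Unique.filter⁺ (T? ∘ isPerm n) (words-unique n n)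

  suc∉ : ∀ {i σ} → IsPermutation i σ → suc i ∉ σ
  suc∉ π si∈ = ℕ.1+n≰n (∈-range⇒≤ (⊆range π si∈))

  insertAt-isPermutation : ∀ {i σ} p → p < suc i → IsPermutation i σ →
                           IsPermutation (suc i) (insertAt p (suc i) σ)
  insertAt-isPermutation {i} {σ} p p< π = record
    { length≡ = trans (length-insertAt p (suc i) σ) (cong suc (length≡ π))
    ; ⊆range  = λ z∈ → [ (λ { refl → suc∈range-suc i }) , ∈-range-suc⁺ ∘ ⊆range π ]′ (∈-insertAt⁻ p (suc i) σ z∈)
    ; range⊆  = λ j∈ → [ (λ { refl → x∈insertAt p (suc i) σ }) , ∈-insertAt⁺ p (suc i) σ ∘ range⊆ π ]′ (∈-range-suc⁻ j∈)
    }

  module _ {i w} (π : IsPermutation (suc i) w) where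

    private
      max∈ : suc i ∈ w
      max∈ = range⊆ π (suc∈range-suc i)

      length-delete-max : length (delete (suc i) w) ≡ i
      length-delete-max = ℕ.suc-injective (trans (length-delete w max∈) (length≡ π))

      range⊆delete : ∀ {j} → j ∈ range i → j ∈ delete (suc i) w
      range⊆delete j∈ = ∈-delete⁺ w (range⊆ π (∈-range-suc⁺ j∈)) (λ { refl → ℕ.1+n≰n (∈-range⇒≤ j∈) })

      -- otherwise delete (suc i) w would contain the i + 1 distinct elements of range (suc i)
      max∉delete : suc i ∉ delete (suc i) w
      max∉delete max∈′ = ℕ.1+n≰n (begin
        suc i                          ≡⟨ length-range (suc i) ⟨
        length (range (suc i))         ≤⟨ unique-⊆⇒length≤ _ (range-unique (suc i)) range-suc⊆ ⟩
        length (delete (suc i) w)      ≡⟨ length-delete-max ⟩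
        i                              ∎)
        where
        open ℕ.≤-Reasoning
        range-suc⊆ : ∀ {j} → j ∈ range (suc i) → j ∈ delete (suc i) w
        range-suc⊆ j∈ = [ (λ { refl → max∈′ }) , range⊆delete ]′ (∈-range-suc⁻ j∈)

    delete-isPermutation : IsPermutation i (delete (suc i) w)
    delete-isPermutation = record
      { length≡ = length-delete-max
      ; ⊆range  = λ z∈ → [ (λ { refl → ⊥-elim (max∉delete z∈) }) , (λ z∈′ → z∈′) ]′
                             (∈-range-suc⁻ (⊆range π (∈-delete⁻ w z∈)))
      ; range⊆  = range⊆delete
      }

    position-max< : position (suc i) w < suc i
    position-max< = s≤s (subst (position (suc i) w ≤_) length-delete-max (position≤length-delete w max∈))

    insertAt-position-max : insertAt (position (suc i) w) (suc i) (delete (suc i) w) ≡ w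
    insertAt-position-max = insertAt-position-delete w max∈

  insertions : ℕ → List ℕ → List (List ℕ)
  insertions i σ = applyUpTo (λ p → insertAt p (suc i) σ) (suc i)

  extendedPerms : ℕ → List (List ℕ)
  extendedPerms i = concatMap (insertions i) (perms i)

  ∈-extendedPerms⁻ : ∀ {i w} → w ∈ extendedPerms i → IsPermutation (suc i) w
  ∈-extendedPerms⁻ {i} w∈ with ∈.∈-concat⁻′ (map (insertions i) (perms i)) w∈
  ... | ws , w∈ws , ws∈ with ∈.∈-map⁻ (insertions i) ws∈
  ... | σ , σ∈ , refl with ∈.∈-applyUpTo⁻ (λ p → insertAt p (suc i) σ) w∈ws
  ... | p , p< , refl = insertAt-isPermutation p p< (∈-perms⁻ σ∈)

  ∈-extendedPerms⁺ : ∀ {i w} → IsPermutation (suc i) w → w ∈ extendedPerms i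
  ∈-extendedPerms⁺ {i} {w} π = subst (_∈ extendedPerms i) (insertAt-position-max π)
    (∈.∈-concat⁺′ (∈.∈-applyUpTo⁺ (λ p → insertAt p (suc i) σ) (position-max< π))
                  (∈.∈-map⁺ (insertions i) (∈-perms⁺ (delete-isPermutation π))))
    where σ = delete (suc i) w

  extendedPerms-unique : ∀ i → Unique (extendedPerms i)
  extendedPerms-unique i = concatMap-unique (insertions i) (perms-unique i) insertions-unique same-base
    where
    insertions-unique : ∀ {σ} → σ ∈ perms i → Unique (insertions i σ)
    insertions-unique {σ} σ∈ = Unique.applyUpTo⁺₁ _ (suc i) distinct
      where
      open ≡-Reasoning
      π : IsPermutation i σ
      π = ∈-perms⁻ σ∈
      distinct : ∀ {p q} → p < q → q < suc i → insertAt p (suc i) σ ≢ insertAt q (suc i) σ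
      distinct {p} {q} p<q (s≤s q≤i) same = ℕ.<⇒≢ p<q (begin
        p
          ≡⟨ position-insertAt p σ (suc∉ π) (ℕ.≤-trans (ℕ.<⇒≤ p<q) q≤σ) ⟨
        position (suc i) (insertAt p (suc i) σ)
          ≡⟨ cong (position (suc i)) same ⟩
        position (suc i) (insertAt q (suc i) σ)
          ≡⟨ position-insertAt q σ (suc∉ π) q≤σ ⟩
        q                                       ∎)
        where q≤σ : q ≤ length σ
              q≤σ = subst (q ≤_) (sym (length≡ π)) q≤i
    same-base : ∀ {σ τ w} → σ ∈ perms i → τ ∈ perms i → w ∈ insertions i σ → w ∈ insertions i τ → σ ≡ τ
    same-base {σ} {τ} σ∈ τ∈ w∈σ w∈τ
      with ∈.∈-applyUpTo⁻ (λ p → insertAt p (suc i) σ) w∈σ | ∈.∈-applyUpTo⁻ (λ p → insertAt p (suc i) τ) w∈τ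
    ... | p , _ , refl | q , _ , same = begin
      σ                                         ≡⟨ delete-insertAt p σ (suc∉ (∈-perms⁻ σ∈)) ⟨
      delete (suc i) (insertAt p (suc i) σ)     ≡⟨ cong (delete (suc i)) same ⟩
      delete (suc i) (insertAt q (suc i) τ)     ≡⟨ delete-insertAt q τ (suc∉ (∈-perms⁻ τ∈)) ⟩
      τ                                         ∎
      where open ≡-Reasoning

  perms-suc↭ : ∀ i → perms (suc i) ↭ extendedPerms i
  perms-suc↭ i = ∼bag⇒↭ (unique∧set⇒bag (perms-unique (suc i)) (extendedPerms-unique i)
    (mk⇔ (∈-extendedPerms⁺ {i} ∘ ∈-perms⁻) (∈-perms⁺ ∘ ∈-extendedPerms⁻ {i})))

module Descents where

  open import Data.Nat as ℕ using (ℕ; zero; suc; _+_; _*_; _<_; s≤s; _≡ᵇ_; _<ᵇ_)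
  import Data.Nat.Properties as ℕ
  open import Data.Nat.ListAction using (sum)
  open import Data.Nat.Tactic.RingSolver using (solve-∀)
  open import Data.Bool using (Bool; true; false; T; if_then_else_)
  open import Data.Bool.Properties using (T-≡)
  open import Data.Empty using (⊥-elim)
  open import Data.List using (List; []; _∷_; _++_; length; map; upTo; applyUpTo; concatMap; filterᵇ)
  import Data.List.Properties as List
  open import Data.List.Membership.Propositional using (_∈_)
  import Data.List.Membership.Propositional.Properties as ∈
  open import Data.List.Relation.Binary.Permutation.Propositional.Properties using (↭-length; filter-↭)
  open import Data.List.Relation.Unary.All as All using (All; []; _∷_)
  open import Data.Product using (_,_)
  open import Data.Sum using (_⊎_; inj₁; inj₂)
  import Data.Sum as Sum
  open import Function using (_∘_; Equivalence)
  open import Relation.Nullary.Decidable using (T?)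
  open import Relation.Binary.PropositionalEquality
  open ≡-Reasoning
  open Permutations

  iverson : Bool → ℕ
  iverson b = if b then 1 else 0

  module _ {A : Set} where

    sum-map-cong : ∀ {f g : A → ℕ} xs → (∀ {x} → x ∈ xs → f x ≡ g x) → sum (map f xs) ≡ sum (map g xs)
    sum-map-cong xs f≡g = cong sum (List.map-cong-local (All.tabulate f≡g))

    sum-map-+ : ∀ (f g : A → ℕ) xs → sum (map (λ x → f x + g x) xs) ≡ sum (map f xs) + sum (map g xs)
    sum-map-+ f g []       = refl
    sum-map-+ f g (x ∷ xs) = trans (cong (f x + g x +_) (sum-map-+ f g xs)) (interchange (f x) (g x) _ _)
      where interchange : ∀ a b c d → a + b + (c + d) ≡ a + c + (b + d)
            interchange = solve-∀

    sum-map-*ʳ : ∀ (f : A → ℕ) c xs → sum (map (λ x → f x * c) xs) ≡ c * sum (map f xs)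
    sum-map-*ʳ f c []       = sym (ℕ.*-zeroʳ c)
    sum-map-*ʳ f c (x ∷ xs) = trans (cong₂ _+_ (ℕ.*-comm (f x) c) (sum-map-*ʳ f c xs))
                                    (sym (ℕ.*-distribˡ-+ c (f x) _))

    sum-map-const : ∀ c (xs : List A) → sum (map (λ _ → c) xs) ≡ length xs * c
    sum-map-const c []       = refl
    sum-map-const c (x ∷ xs) = cong (c +_) (sum-map-const c xs)

    length-filterᵇ : ∀ (p : A → Bool) xs → length (filterᵇ p xs) ≡ sum (map (iverson ∘ p) xs)
    length-filterᵇ p []       = refl
    length-filterᵇ p (x ∷ xs) with p x
    ... | true  = cong suc (length-filterᵇ p xs)
    ... | false = length-filterᵇ p xs

    length-filterᵇ-concatMap : ∀ {B : Set} (p : B → Bool) (f : A → List B) xs →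
      length (filterᵇ p (concatMap f xs)) ≡ sum (map (λ x → length (filterᵇ p (f x))) xs)
    length-filterᵇ-concatMap p f []       = refl
    length-filterᵇ-concatMap p f (x ∷ xs) = begin
      length (filterᵇ p (f x ++ concatMap f xs))
        ≡⟨ cong length (List.filter-++ (T? ∘ p) (f x) (concatMap f xs)) ⟩
      length (filterᵇ p (f x) ++ filterᵇ p (concatMap f xs))
        ≡⟨ List.length-++ (filterᵇ p (f x)) ⟩
      length (filterᵇ p (f x)) + length (filterᵇ p (concatMap f xs))
        ≡⟨ cong (length (filterᵇ p (f x)) +_) (length-filterᵇ-concatMap p f xs) ⟩
      length (filterᵇ p (f x)) + sum (map (λ x → length (filterᵇ p (f x))) xs) ∎

  sum-applyUpTo : ∀ (f : ℕ → ℕ) m → sum (applyUpTo f m) ≡ sum (map f (upTo m))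
  sum-applyUpTo f m = cong sum (sym (List.map-upTo f m))

  sum-applyUpTo-cong : ∀ {f g : ℕ → ℕ} m → (∀ p → f p ≡ g p) → sum (applyUpTo f m) ≡ sum (applyUpTo g m)
  sum-applyUpTo-cong zero    f≡g = refl
  sum-applyUpTo-cong (suc m) f≡g = cong₂ _+_ (f≡g 0) (sum-applyUpTo-cong m (f≡g ∘ suc))

  sum-applyUpTo-+ : ∀ (f g : ℕ → ℕ) m →
    sum (applyUpTo (λ p → f p + g p) m) ≡ sum (applyUpTo f m) + sum (applyUpTo g m)
  sum-applyUpTo-+ f g m = begin
    sum (applyUpTo (λ p → f p + g p) m)          ≡⟨ sum-applyUpTo (λ p → f p + g p) m ⟩
    sum (map (λ p → f p + g p) (upTo m))         ≡⟨ sum-map-+ f g (upTo m) ⟩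
    sum (map f (upTo m)) + sum (map g (upTo m))  ≡⟨ cong₂ _+_ (sum-applyUpTo f m) (sum-applyUpTo g m) ⟨
    sum (applyUpTo f m) + sum (applyUpTo g m)    ∎

  sum-applyUpTo-const : ∀ c m → sum (applyUpTo (λ _ → c) m) ≡ m * c
  sum-applyUpTo-const c zero    = refl
  sum-applyUpTo-const c (suc m) = cong (c +_) (sum-applyUpTo-const c m)

  ≡ᵇ-refl : ∀ n → (n ≡ᵇ n) ≡ true
  ≡ᵇ-refl zero    = refl
  ≡ᵇ-refl (suc n) = ≡ᵇ-refl n

  n≡ᵇ1+n : ∀ n → (n ≡ᵇ suc n) ≡ false
  n≡ᵇ1+n zero    = refl
  n≡ᵇ1+n (suc n) = n≡ᵇ1+n n

  1+n≡ᵇn : ∀ n → (suc n ≡ᵇ n) ≡ false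
  1+n≡ᵇn zero    = refl
  1+n≡ᵇn (suc n) = 1+n≡ᵇn n

  iverson-≡ᵇ-* : ∀ m k (f : ℕ → ℕ) → iverson (m ≡ᵇ k) * f m ≡ iverson (m ≡ᵇ k) * f k
  iverson-≡ᵇ-* m k f with m ≡ᵇ k in eq
  ... | true  = cong (λ j → 1 * f j) (ℕ.≡ᵇ⇒≡ m k (Equivalence.from T-≡ eq))
  ... | false = refl

  <ᵇ-true : ∀ {m n} → m < n → (m <ᵇ n) ≡ true
  <ᵇ-true m<n = Equivalence.to T-≡ (ℕ.<⇒<ᵇ m<n)

  <ᵇ-false : ∀ {m n} → n < m → (m <ᵇ n) ≡ false
  <ᵇ-false {m} {n} n<m with m <ᵇ n in eq
  ... | true  = ⊥-elim (ℕ.<-asym n<m (ℕ.<ᵇ⇒< m n (Equivalence.from T-≡ eq)))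
  ... | false = refl

  module _ {m d : ℕ} where

    two-valued-split : m ≡ d ⊎ m ≡ suc d → m ≡ d + iverson (m ≡ᵇ suc d)
    two-valued-split (inj₁ refl) rewrite n≡ᵇ1+n d = sym (ℕ.+-identityʳ d)
    two-valued-split (inj₂ refl) rewrite ≡ᵇ-refl d = ℕ.+-comm 1 d

    two-valued-partition : m ≡ d ⊎ m ≡ suc d → iverson (m ≡ᵇ d) + iverson (m ≡ᵇ suc d) ≡ 1
    two-valued-partition (inj₁ refl) rewrite ≡ᵇ-refl d | n≡ᵇ1+n d = refl
    two-valued-partition (inj₂ refl) rewrite ≡ᵇ-refl d | 1+n≡ᵇn d = refl

    two-valued-indicator : m ≡ d ⊎ m ≡ suc d → ∀ k →
      iverson (m ≡ᵇ k) ≡ iverson (m ≡ᵇ d) * iverson (d ≡ᵇ k) + iverson (m ≡ᵇ suc d) * iverson (suc d ≡ᵇ k)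
    two-valued-indicator (inj₁ refl) k rewrite ≡ᵇ-refl d | n≡ᵇ1+n d = sym (trans (ℕ.+-identityʳ _) (ℕ.+-identityʳ _))
    two-valued-indicator (inj₂ refl) k rewrite ≡ᵇ-refl d | 1+n≡ᵇn d = sym (ℕ.+-identityʳ _)

  module TwoValued {A : Set} (v : A → ℕ) (d : ℕ) {xs : List A}
                   (two : ∀ {x} → x ∈ xs → v x ≡ d ⊎ v x ≡ suc d) where

    count : ℕ → ℕ
    count k = sum (map (λ x → iverson (v x ≡ᵇ k)) xs)

    count-split : ∀ k → count k ≡ iverson (d ≡ᵇ k) * count d + iverson (suc d ≡ᵇ k) * count (suc d)
    count-split k = begin
      count k
        ≡⟨ sum-map-cong xs (λ x∈ → two-valued-indicator (two x∈) k) ⟩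
      sum (map (λ x → [ x ]d * iverson (d ≡ᵇ k) + [ x ]d+1 * iverson (suc d ≡ᵇ k)) xs)
        ≡⟨ sum-map-+ (λ x → [ x ]d * iverson (d ≡ᵇ k)) (λ x → [ x ]d+1 * iverson (suc d ≡ᵇ k)) xs ⟩
      sum (map (λ x → [ x ]d * iverson (d ≡ᵇ k)) xs) + sum (map (λ x → [ x ]d+1 * iverson (suc d ≡ᵇ k)) xs)
        ≡⟨ cong₂ _+_ (sum-map-*ʳ [_]d (iverson (d ≡ᵇ k)) xs) (sum-map-*ʳ [_]d+1 (iverson (suc d ≡ᵇ k)) xs) ⟩
      iverson (d ≡ᵇ k) * count d + iverson (suc d ≡ᵇ k) * count (suc d) ∎
      where
      [_]d [_]d+1 : A → ℕ
      [ x ]d   = iverson (v x ≡ᵇ d)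
      [ x ]d+1 = iverson (v x ≡ᵇ suc d)

    count-total : count d + count (suc d) ≡ length xs
    count-total = begin
      count d + count (suc d)
        ≡⟨ sum-map-+ (λ x → iverson (v x ≡ᵇ d)) (λ x → iverson (v x ≡ᵇ suc d)) xs ⟨
      sum (map (λ x → iverson (v x ≡ᵇ d) + iverson (v x ≡ᵇ suc d)) xs)
        ≡⟨ sum-map-cong xs (two-valued-partition ∘ two) ⟩
      sum (map (λ _ → 1) xs)
        ≡⟨ sum-map-const 1 xs ⟩
      length xs * 1
        ≡⟨ ℕ.*-identityʳ _ ⟩
      length xs ∎

    sum-values : sum (map v xs) ≡ length xs * d + count (suc d)
    sum-values = begin
      sum (map v xs)
        ≡⟨ sum-map-cong xs (two-valued-split ∘ two) ⟩
      sum (map (λ x → d + iverson (v x ≡ᵇ suc d)) xs)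
        ≡⟨ sum-map-+ (λ _ → d) (λ x → iverson (v x ≡ᵇ suc d)) xs ⟩
      sum (map (λ _ → d) xs) + count (suc d)
        ≡⟨ cong (_+ count (suc d)) (sum-map-const d xs) ⟩
      length xs * d + count (suc d) ∎

    -- d + 1 of the values equal d and n ∸ d equal d + 1; both sides are shifted by [d + 1 = k] · d
    -- so that no subtraction occurs.
    count-two-valued : ∀ n → length xs ≡ suc n → sum (map v xs) ≡ n * suc d → ∀ k →
      count k + iverson (suc d ≡ᵇ k) * d ≡ iverson (d ≡ᵇ k) * suc d + iverson (suc d ≡ᵇ k) * n
    count-two-valued n length≡ total k = begin
      count k + iverson (suc d ≡ᵇ k) * d
        ≡⟨ cong (_+ iverson (suc d ≡ᵇ k) * d) (count-split k) ⟩
      iverson (d ≡ᵇ k) * count d + iverson (suc d ≡ᵇ k) * count (suc d) + iverson (suc d ≡ᵇ k) * d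
        ≡⟨ regroup (iverson (d ≡ᵇ k)) (iverson (suc d ≡ᵇ k)) (count d) (count (suc d)) d ⟩
      iverson (d ≡ᵇ k) * count d + iverson (suc d ≡ᵇ k) * (count (suc d) + d)
        ≡⟨ cong₂ (λ x y → iverson (d ≡ᵇ k) * x + iverson (suc d ≡ᵇ k) * y) count-d count-d+1+d ⟩
      iverson (d ≡ᵇ k) * suc d + iverson (suc d ≡ᵇ k) * n ∎
      where
      regroup : ∀ p q a b d → p * a + q * b + q * d ≡ p * a + q * (b + d)
      regroup = solve-∀
      count-d+1+d : count (suc d) + d ≡ n
      count-d+1+d = ℕ.+-cancelʳ-≡ (n * d) (count (suc d) + d) n (begin
        count (suc d) + d + n * d        ≡⟨ shuffle (count (suc d)) d n ⟩
        suc n * d + count (suc d)        ≡⟨ cong (λ l → l * d + count (suc d)) length≡ ⟨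
        length xs * d + count (suc d)    ≡⟨ sum-values ⟨
        sum (map v xs)                   ≡⟨ total ⟩
        n * suc d                        ≡⟨ ℕ.*-suc n d ⟩
        n + n * d                        ∎)
        where shuffle : ∀ b d n → b + d + n * d ≡ suc n * d + b
              shuffle = solve-∀
      count-d : count d ≡ suc d
      count-d = ℕ.+-cancelʳ-≡ (count (suc d)) (count d) (suc d) (begin
        count d + count (suc d)          ≡⟨ count-total ⟩
        length xs                        ≡⟨ length≡ ⟩
        suc n                            ≡⟨ cong suc count-d+1+d ⟨
        suc (count (suc d) + d)          ≡⟨ cong suc (ℕ.+-comm (count (suc d)) d) ⟩
        suc d + count (suc d)            ∎)

  firstDescent : ℕ → List ℕ → ℕ
  firstDescent y []      = 0
  firstDescent y (z ∷ _) = iverson (z <ᵇ y)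

  des-∷ : ∀ y w → des (y ∷ w) ≡ firstDescent y w + des w
  des-∷ y []      = refl
  des-∷ y (z ∷ w) = refl

  firstDescent-insertAt-suc : ∀ {x y} p τ → y < x → firstDescent y (insertAt (suc p) x τ) ≡ firstDescent y τ
  firstDescent-insertAt-suc p []      y<x = cong iverson (<ᵇ-false y<x)
  firstDescent-insertAt-suc p (z ∷ τ) _   = refl

  des-insertAt-max : ∀ {x} σ → All (_< x) σ → ∀ p →
                     des (insertAt p x σ) ≡ des σ ⊎ des (insertAt p x σ) ≡ suc (des σ)
  des-insertAt-max []      _ zero    = inj₁ refl
  des-insertAt-max []      _ (suc p) = inj₁ refl
  des-insertAt-max (y ∷ τ) (y<x ∷ _) zero = inj₂ (cong (λ b → iverson b + des (y ∷ τ)) (<ᵇ-true y<x))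
  des-insertAt-max {x} (y ∷ []) (y<x ∷ _) (suc p) = inj₁ (begin
    des (y ∷ insertAt p x [])
      ≡⟨ des-∷ y (insertAt p x []) ⟩
    firstDescent y (insertAt p x []) + des (insertAt p x [])
      ≡⟨ cong₂ _+_ (lone p) (cong des (insertAt-[] p)) ⟩
    0 ∎)
    where
    insertAt-[] : ∀ p → insertAt p x [] ≡ x ∷ []
    insertAt-[] zero    = refl
    insertAt-[] (suc p) = refl
    lone : ∀ p → firstDescent y (insertAt p x []) ≡ 0
    lone p rewrite insertAt-[] p = cong iverson (<ᵇ-false y<x)
  des-insertAt-max {x} (y ∷ z ∷ ρ) (y<x ∷ z<x ∷ _) (suc zero)
    rewrite <ᵇ-false y<x | <ᵇ-true z<x with z <ᵇ y
  ... | true  = inj₁ refl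
  ... | false = inj₂ refl
  des-insertAt-max {x} (y ∷ z ∷ ρ) (y<x ∷ zρ<x) (suc (suc p)) =
    Sum.map (cong (iverson (z <ᵇ y) +_)) (λ eq → trans (cong (iverson (z <ᵇ y) +_) eq) (ℕ.+-suc _ _))
            (des-insertAt-max (z ∷ ρ) zρ<x (suc p))

  sum-des-insertAt-max : ∀ {x} σ → All (_< x) σ →
    sum (applyUpTo (λ p → des (insertAt p x σ)) (suc (length σ))) ≡ length σ * suc (des σ)
  sum-des-insertAt-max []                  _            = refl
  sum-des-insertAt-max {x} (y ∷ τ) (y<x ∷ τ<x) = begin
    des (x ∷ y ∷ τ) + sum (applyUpTo (λ q → des (y ∷ insertAt q x τ)) (suc n))
      ≡⟨ cong₂ _+_ front rest ⟩
    suc (des (y ∷ τ)) + (n * firstDescent y τ + n * suc (des τ))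
      ≡⟨ cong (λ d → suc d + (n * firstDescent y τ + n * suc (des τ))) (des-∷ y τ) ⟩
    suc (firstDescent y τ + des τ) + (n * firstDescent y τ + n * suc (des τ))
      ≡⟨ collect n (firstDescent y τ) (des τ) ⟩
    suc n * suc (firstDescent y τ + des τ)
      ≡⟨ cong (λ d → suc n * suc d) (des-∷ y τ) ⟨
    suc n * suc (des (y ∷ τ))
      ∎
    where
    n : ℕ
    n = length τ
    collect : ∀ n f d → suc (f + d) + (n * f + n * suc d) ≡ suc n * suc (f + d)
    collect = solve-∀
    front : des (x ∷ y ∷ τ) ≡ suc (des (y ∷ τ))
    front = cong (λ b → iverson b + des (y ∷ τ)) (<ᵇ-true y<x)
    firsts : sum (applyUpTo (λ q → firstDescent y (insertAt q x τ)) (suc n)) ≡ n * firstDescent y τ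
    firsts = begin
      iverson (x <ᵇ y) + sum (applyUpTo (λ q → firstDescent y (insertAt (suc q) x τ)) n)
        ≡⟨ cong₂ _+_ (cong iverson (<ᵇ-false y<x)) (sum-applyUpTo-cong n (λ q → firstDescent-insertAt-suc q τ y<x)) ⟩
      sum (applyUpTo (λ _ → firstDescent y τ) n)
        ≡⟨ sum-applyUpTo-const (firstDescent y τ) n ⟩
      n * firstDescent y τ ∎
    rest : sum (applyUpTo (λ q → des (y ∷ insertAt q x τ)) (suc n)) ≡ n * firstDescent y τ + n * suc (des τ)
    rest = begin
      sum (applyUpTo (λ q → des (y ∷ insertAt q x τ)) (suc n))
        ≡⟨ sum-applyUpTo-cong (suc n) (λ q → des-∷ y (insertAt q x τ)) ⟩
      sum (applyUpTo (λ q → firstDescent y (insertAt q x τ) + des (insertAt q x τ)) (suc n))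
        ≡⟨ sum-applyUpTo-+ (λ q → firstDescent y (insertAt q x τ)) (λ q → des (insertAt q x τ)) (suc n) ⟩
      sum (applyUpTo (λ q → firstDescent y (insertAt q x τ)) (suc n)) + sum (applyUpTo (λ q → des (insertAt q x τ)) (suc n))
        ≡⟨ cong₂ _+_ firsts (sum-des-insertAt-max τ τ<x) ⟩
      n * firstDescent y τ + n * suc (des τ) ∎

  insertions-count : ∀ {i σ} → σ ∈ perms i → ∀ k →
    length (filterᵇ (λ w → des w ≡ᵇ k) (insertions i σ)) + iverson (suc (des σ) ≡ᵇ k) * des σ
      ≡ iverson (des σ ≡ᵇ k) * suc (des σ) + iverson (suc (des σ) ≡ᵇ k) * i
  insertions-count {i} {σ} σ∈ k = begin
    length (filterᵇ (λ w → des w ≡ᵇ k) (insertions i σ)) + iverson (suc (des σ) ≡ᵇ k) * des σ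
      ≡⟨ cong (_+ iverson (suc (des σ) ≡ᵇ k) * des σ) (length-filterᵇ (λ w → des w ≡ᵇ k) (insertions i σ)) ⟩
    sum (map (λ w → iverson (des w ≡ᵇ k)) (insertions i σ)) + iverson (suc (des σ) ≡ᵇ k) * des σ
      ≡⟨ TwoValued.count-two-valued des (des σ) two i length≡ total k ⟩
    iverson (des σ ≡ᵇ k) * suc (des σ) + iverson (suc (des σ) ≡ᵇ k) * i ∎
    where
    π : IsPermutation i σ
    π = ∈-perms⁻ σ∈
    below : All (_< suc i) σ
    below = All.tabulate (λ z∈ → s≤s (∈-range⇒≤ (IsPermutation.⊆range π z∈)))
    length≡ : length (insertions i σ) ≡ suc i
    length≡ = List.length-applyUpTo (λ p → insertAt p (suc i) σ) (suc i)
    two : ∀ {w} → w ∈ insertions i σ → des w ≡ des σ ⊎ des w ≡ suc (des σ)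
    two w∈ with ∈.∈-applyUpTo⁻ (λ p → insertAt p (suc i) σ) w∈
    ... | p , _ , refl = des-insertAt-max σ below p
    total : sum (map des (insertions i σ)) ≡ i * suc (des σ)
    total = trans (cong sum (List.map-applyUpTo (λ p → insertAt p (suc i) σ) des (suc i)))
      (subst (λ n → sum (applyUpTo (λ p → des (insertAt p (suc i) σ)) (suc n)) ≡ n * suc (des σ))
             (IsPermutation.length≡ π) (sum-des-insertAt-max σ below))

  eulerianNumber : ℕ → ℕ → ℕ
  eulerianNumber i k = length (filterᵇ (λ σ → des σ ≡ᵇ k) (perms i))

  weighted-eulerianNumber : ∀ i k c →
    sum (map (λ σ → iverson (des σ ≡ᵇ k) * c) (perms i)) ≡ c * eulerianNumber i k
  weighted-eulerianNumber i k c = trans (sum-map-*ʳ (λ σ → iverson (des σ ≡ᵇ k)) c (perms i))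
    (cong (c *_) (sym (length-filterᵇ (λ σ → des σ ≡ᵇ k) (perms i))))

  eulerianNumber-suc : ∀ i k →
    eulerianNumber (suc i) k + sum (map (λ σ → iverson (suc (des σ) ≡ᵇ k) * des σ) (perms i))
      ≡ sum (map (λ σ → iverson (des σ ≡ᵇ k) * suc (des σ) + iverson (suc (des σ) ≡ᵇ k) * i) (perms i))
  eulerianNumber-suc i k = begin
    eulerianNumber (suc i) k + shiftSum
      ≡⟨ cong (_+ shiftSum) (↭-length (filter-↭ (T? ∘ P) (perms-suc↭ i))) ⟩
    length (filterᵇ P (extendedPerms i)) + shiftSum
      ≡⟨ cong (_+ shiftSum) (length-filterᵇ-concatMap P (insertions i) (perms i)) ⟩
    sum (map count (perms i)) + shiftSum
      ≡⟨ sum-map-+ count (λ σ → iverson (suc (des σ) ≡ᵇ k) * des σ) (perms i) ⟨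
    sum (map (λ σ → count σ + iverson (suc (des σ) ≡ᵇ k) * des σ) (perms i))
      ≡⟨ sum-map-cong (perms i) (λ σ∈ → insertions-count σ∈ k) ⟩
    sum (map (λ σ → iverson (des σ ≡ᵇ k) * suc (des σ) + iverson (suc (des σ) ≡ᵇ k) * i) (perms i)) ∎
    where
    P : List ℕ → Bool
    P w = des w ≡ᵇ k
    count : List ℕ → ℕ
    count σ = length (filterᵇ P (insertions i σ))
    shiftSum : ℕ
    shiftSum = sum (map (λ σ → iverson (suc (des σ) ≡ᵇ k) * des σ) (perms i))

  eulerianNumber-suc-zero : ∀ i → eulerianNumber (suc i) 0 ≡ eulerianNumber i 0
  eulerianNumber-suc-zero i = begin
    eulerianNumber (suc i) 0
      ≡⟨ ℕ.+-identityʳ _ ⟨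
    eulerianNumber (suc i) 0 + 0
      ≡⟨ cong (eulerianNumber (suc i) 0 +_) (trans (sum-map-const 0 (perms i)) (ℕ.*-zeroʳ (length (perms i)))) ⟨
    eulerianNumber (suc i) 0 + sum (map (λ _ → 0) (perms i))
      ≡⟨ eulerianNumber-suc i 0 ⟩
    sum (map (λ σ → iverson (des σ ≡ᵇ 0) * suc (des σ) + 0) (perms i))
      ≡⟨ sum-map-cong (perms i) (λ {σ} _ → only-zero (des σ)) ⟩
    sum (map (λ σ → iverson (des σ ≡ᵇ 0) * 1) (perms i))
      ≡⟨ weighted-eulerianNumber i 0 1 ⟩
    1 * eulerianNumber i 0
      ≡⟨ ℕ.*-identityˡ _ ⟩
    eulerianNumber i 0 ∎
    where
    only-zero : ∀ d → iverson (d ≡ᵇ 0) * suc d + 0 ≡ iverson (d ≡ᵇ 0) * 1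
    only-zero zero    = refl
    only-zero (suc d) = refl

  -- stated without subtraction: A(i+1, k+1) = (k+2) A(i, k+1) + (i-k) A(i, k)
  eulerianNumber-suc-suc : ∀ i k →
    eulerianNumber (suc i) (suc k) + k * eulerianNumber i k
      ≡ suc (suc k) * eulerianNumber i (suc k) + i * eulerianNumber i k
  eulerianNumber-suc-suc i k = begin
    eulerianNumber (suc i) (suc k) + k * eulerianNumber i k
      ≡⟨ cong (eulerianNumber (suc i) (suc k) +_) shifted ⟩
    eulerianNumber (suc i) (suc k) + sum (map (λ σ → iverson (des σ ≡ᵇ k) * des σ) (perms i))
      ≡⟨ eulerianNumber-suc i (suc k) ⟩
    sum (map (λ σ → iverson (des σ ≡ᵇ suc k) * suc (des σ) + iverson (des σ ≡ᵇ k) * i) (perms i))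
      ≡⟨ sum-map-cong (perms i) (λ {σ} _ → cong (_+ iverson (des σ ≡ᵇ k) * i) (iverson-≡ᵇ-* (des σ) (suc k) suc)) ⟩
    sum (map (λ σ → iverson (des σ ≡ᵇ suc k) * suc (suc k) + iverson (des σ ≡ᵇ k) * i) (perms i))
      ≡⟨ sum-map-+ (λ σ → iverson (des σ ≡ᵇ suc k) * suc (suc k)) (λ σ → iverson (des σ ≡ᵇ k) * i) (perms i) ⟩
    sum (map (λ σ → iverson (des σ ≡ᵇ suc k) * suc (suc k)) (perms i)) + sum (map (λ σ → iverson (des σ ≡ᵇ k) * i) (perms i))
      ≡⟨ cong₂ _+_ (weighted-eulerianNumber i (suc k) (suc (suc k))) (weighted-eulerianNumber i k i) ⟩
    suc (suc k) * eulerianNumber i (suc k) + i * eulerianNumber i k ∎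
    where
    shifted : k * eulerianNumber i k ≡ sum (map (λ σ → iverson (des σ ≡ᵇ k) * des σ) (perms i))
    shifted = trans (sym (weighted-eulerianNumber i k k))
                    (sum-map-cong (perms i) (λ {σ} _ → sym (iverson-≡ᵇ-* (des σ) k (λ d → d))))


module EulerianPolynomials where

  open import Data.Nat as ℕ using (ℕ; zero; suc)
  open import Data.Integer using (ℤ; +_; _+_; _*_; _-_)
  import Data.Integer.Properties as ℤ
  open import Data.Integer.Tactic.RingSolver using (solve-∀)
  open import Relation.Binary.PropositionalEquality
  open ≡-Reasoning
  open Descents using (eulerianNumber; eulerianNumber-suc-zero; eulerianNumber-suc-suc)
  open EulerianGeneratingFunction using (EulerianRecurrence)

  pos-+-* : ∀ x y z → + (x ℕ.+ y ℕ.* z) ≡ + x + + y * + z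
  pos-+-* x y z = trans (ℤ.pos-+ x (y ℕ.* z)) (cong (_+_ (+ x)) (ℤ.pos-* y z))

  eulerian-step : ∀ i k →
    Eulerian (suc i) (suc k) ≡ + suc (suc k) * Eulerian i (suc k) + (+ i - + k) * Eulerian i k
  eulerian-step i k = begin
    x                            ≡⟨ cancel x (+ k * b) ⟩
    x + + k * b - + k * b        ≡⟨ cong (_- + k * b) integral ⟩
    c * a + + i * b - + k * b    ≡⟨ collect c a (+ i) (+ k) b ⟩
    c * a + (+ i - + k) * b      ∎
    where
    x a b c : ℤ
    x = Eulerian (suc i) (suc k)
    a = Eulerian i (suc k)
    b = Eulerian i k
    c = + suc (suc k)
    cancel : ∀ x y → x ≡ x + y - y
    cancel = solve-∀
    collect : ∀ c a i k b → c * a + i * b - k * b ≡ c * a + (i - k) * b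
    collect = solve-∀
    integral : x + + k * b ≡ c * a + + i * b
    integral = begin
      x + + k * b
        ≡⟨ pos-+-* (eulerianNumber (suc i) (suc k)) k (eulerianNumber i k) ⟨
      + (eulerianNumber (suc i) (suc k) ℕ.+ k ℕ.* eulerianNumber i k)
        ≡⟨ cong +_ (eulerianNumber-suc-suc i k) ⟩
      + (suc (suc k) ℕ.* eulerianNumber i (suc k) ℕ.+ i ℕ.* eulerianNumber i k)
        ≡⟨ pos-+-* (suc (suc k) ℕ.* eulerianNumber i (suc k)) i (eulerianNumber i k) ⟩
      + (suc (suc k) ℕ.* eulerianNumber i (suc k)) + + i * b
        ≡⟨ cong (_+ + i * b) (ℤ.pos-* (suc (suc k)) (eulerianNumber i (suc k))) ⟩
      c * a + + i * b ∎

  eulerian-recurrence : EulerianRecurrence Eulerian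
  eulerian-recurrence = record
    { initial  = λ { zero → refl ; (suc n) → refl }
    ; constant = λ i → cong +_ (eulerianNumber-suc-zero i)
    ; step     = eulerian-step
    }

module DerivativeOfRiordanArrays where

  open import Data.Nat as ℕ using (ℕ; zero; suc)
  import Data.Nat.Properties as ℕ
  open import Data.Integer using (+_; _*_)
  open import Data.Product using (_×_; _,_; proj₁; proj₂)
  open import Relation.Binary.PropositionalEquality
  open PowerSeries

  infix 4 _≗₂_
  _≗₂_ : FPS × FPS → FPS × FPS → Set
  p ≗₂ q = proj₁ p ≗ proj₁ q × proj₂ p ≗ proj₂ q

  Der-cong : ∀ {p q} → p ≗₂ q → Der p ≗₂ Der q
  Der-cong (d≗ , h≗) = (λ n → cong (+ suc n *_) (h≗ (suc n))) , ⊛-congˡ X d≗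

  RiordanP-cong : ∀ {p q} → p ≗₂ q → ∀ n k → RiordanP p n k ≡ RiordanP q n k
  RiordanP-cong (d≗ , h≗) n k = ⊛-cong d≗ (pow-cong k h≗) n

  RiordanP≡Riordan : ∀ {p d d′ h h′} → p ≗₂ (d , X ⊛ h) → d′ ≗ d → h′ ≗ h →
                  ∀ n k → RiordanP p n k ≡ Riordan d′ (X ⊛ h′) n k
  RiordanP≡Riordan p≗ d′≗ h′≗ n k =
    trans (RiordanP-cong p≗ n k) (sym (RiordanP-cong (d′≗ , ⊛-congˡ X h′≗) n k))

  module DerChain (G : ℕ → FPS) (G-step : ∀ i → deriv (X ⊛ G i) ≗ G (suc i))
                  {p : FPS × FPS} (p≗ : p ≗₂ (G 0 , X ⊛ G 0)) where

    Der-step : ∀ {q g} i → q ≗₂ (g , X ⊛ G i) → Der q ≗₂ (G (suc i) , X ⊛ g)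
    Der-step i q≗ with d≗ , h≗ ← Der-cong q≗ = (λ n → trans (d≗ n) (G-step i n)) , h≗

    Der^-odd  : ∀ i → Der^ (suc (2 ℕ.* i)) p ≗₂ (G (suc i) , X ⊛ G i)
    Der^-even : ∀ i → Der^ (2 ℕ.* i) p ≗₂ (G i , X ⊛ G i)

    Der^-odd i = Der-step i (Der^-even i)

    Der^-even zero    = p≗
    Der^-even (suc i) = subst (λ m → Der^ m p ≗₂ (G (suc i) , X ⊛ G (suc i))) (sym (ℕ.*-suc 2 i))
                              (Der-step i (Der^-odd i))

open import Data.Nat using (ℕ; suc; _+_; _*_)
open import Data.Integer using (ℤ)
open import Data.Product using (_×_; _,_)
open import Relation.Binary.PropositionalEquality using (_≡_; _≗_)

theorem5p2 : (i : ℕ) →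
    ((n k : ℕ) → RiordanP (Der^ (2 * i) Pas) n k
                 ≡ Riordan (Eulerian i ⊛ inv (pow oneMinusT (suc i)))
                           (X ⊛ (Eulerian i ⊛ inv (pow oneMinusT (suc i)))) n k)
    × ((n k : ℕ) → RiordanP (Der^ (suc (2 * i)) Pas) n k
                 ≡ Riordan (Eulerian (suc i) ⊛ inv (pow oneMinusT (suc (suc i))))
                           (X ⊛ (Eulerian i ⊛ inv (pow oneMinusT (suc i)))) n k)
    × ((n k : ℕ) → RiordanP (Der^ (2 * i) PasInv) n k
                 ≡ Riordan (negArg (Eulerian i) ⊛ inv (pow onePlusT (suc i)))
                           (X ⊛ (negArg (Eulerian i) ⊛ inv (pow onePlusT (suc i)))) n k)
    × ((n k : ℕ) → RiordanP (Der^ (suc (2 * i)) PasInv) n k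
                 ≡ Riordan (negArg (Eulerian (suc i)) ⊛ inv (pow onePlusT (suc (suc i))))
                           (X ⊛ (negArg (Eulerian i) ⊛ inv (pow onePlusT (suc i)))) n k)
theorem5p2 i =
    RiordanP≡Riordan (PasChain.Der^-even i)    (quotient i)         (quotient i)
  , RiordanP≡Riordan (PasChain.Der^-odd i)     (quotient (suc i))   (quotient i)
  , RiordanP≡Riordan (PasInvChain.Der^-even i) (quotient⁻ i)        (quotient⁻ i)
  , RiordanP≡Riordan (PasInvChain.Der^-odd i)  (quotient⁻ (suc i))  (quotient⁻ i)
  where
  open PowerSeries using (⊛-congˡ)
  open EulerianGeneratingFunction
  open DerivativeOfRiordanArrays
  open EulerianPolynomials using (eulerian-recurrence)

  quotient : ∀ i → Eulerian i ⊛ inv (pow oneMinusT (suc i)) ≗ sucPow i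
  quotient = eulerian-quotient eulerian-recurrence
  quotient⁻ : ∀ i → negArg (Eulerian i) ⊛ inv (pow onePlusT (suc i)) ≗ negArg (sucPow i)
  quotient⁻ = eulerian-quotient-negArg eulerian-recurrence

  module PasChain = DerChain sucPow deriv-X⊛-sucPow (inv-oneMinusT , ⊛-congˡ X inv-oneMinusT)
  module PasInvChain = DerChain (λ i → negArg (sucPow i)) deriv-X⊛-negArg-sucPow
                                (inv-onePlusT , ⊛-congˡ X inv-onePlusT)
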